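{- The number of edges of the Hasse diagram of $\mathcal{AD}(BC_n)$ equals $(n+1)\binom{2n}{n+1}=n\binom{2n}{n}$.
   Context: $\Delta^+(BC_n)=\{\varepsilon_i\pm\varepsilon_j\ (1\le i<j\le n),\ \varepsilon_i,\ 2\varepsilon_i\ (1\le i\le n)\}$ with simple roots $\varepsilon_i-\varepsilon_{i+1}$ ($i<n$), $\varepsilon_n$, ordered by the root order (generated by $\gamma$ covering $\mu$ iff $\gamma-\mu$ is simple). $\mathcal{AD}(BC_n)$ is the poset, ordered by inclusion, of upper ideals (up-closed subsets) of $\Delta^+(BC_n)$. -}

module Defs where

open import Data.Nat using (ℕ; zero; suc; _≡ᵇ_)
open import Data.Fin as F using (Fin; toℕ; _<?_)
open import Data.Integer as ℤ using (ℤ; 0ℤ; 1ℤ)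
open import Data.Vec as V using (Vec; tabulate; zipWith)
open import Data.List as L using (List; []; _∷_; _++_; concatMap; allFin; length)
open import Data.List.Relation.Unary.Any using (Any)
open import Data.List.Relation.Unary.Unique.Propositional using (Unique)
open import Data.Fin.Subset using (Subset; _∈_; _⊂_)
open import Data.Bool using (if_then_else_)
open import Data.Product using (_×_; Σ)
open import Function.Bundles using (_⇔_)
open import Relation.Nullary using (¬_; does)
open import Relation.Binary.PropositionalEquality using (_≡_)
open import Relation.Binary.Construct.Closure.ReflexiveTransitive using (Star)

ε : {n : ℕ} → Fin n → Vec ℤ n
ε i = tabulate (λ k → if does (k F.≟ i) then 1ℤ else 0ℤ)

_⊕_ _⊖_ : {n : ℕ} → Vec ℤ n → Vec ℤ n → Vec ℤ n
u ⊕ v = zipWith ℤ._+_ u v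
u ⊖ v = zipWith ℤ._-_ u v

posRoots : (n : ℕ) → List (Vec ℤ n)
posRoots n =
  concatMap (λ i → concatMap (λ j →
      if does (i <? j) then (ε i ⊖ ε j) ∷ (ε i ⊕ ε j) ∷ [] else []) (allFin n)) (allFin n)
  ++ concatMap (λ i → ε i ∷ (ε i ⊕ ε i) ∷ []) (allFin n)

simpleRoots : (n : ℕ) → List (Vec ℤ n)
simpleRoots n =
  concatMap (λ i → concatMap (λ j →
      if toℕ j ≡ᵇ suc (toℕ i) then (ε i ⊖ ε j) ∷ [] else []) (allFin n)) (allFin n)
  ++ concatMap (λ i → if suc (toℕ i) ≡ᵇ n then ε i ∷ [] else []) (allFin n)

N : ℕ → ℕ
N n = length (posRoots n)

root : (n : ℕ) → Fin (N n) → Vec ℤ n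
root n = L.lookup (posRoots n)

Covers : (n : ℕ) → Fin (N n) → Fin (N n) → Set
Covers n a b = Any (root n a ⊖ root n b ≡_) (simpleRoots n)

RootGeq : (n : ℕ) → Fin (N n) → Fin (N n) → Set
RootGeq n a b = Star (Covers n) a b

IsUpperIdeal : (n : ℕ) → Subset (N n) → Set
IsUpperIdeal n I = ∀ a b → b ∈ I → RootGeq n a b → a ∈ I

HasseEdge : (n : ℕ) → Subset (N n) × Subset (N n) → Set
HasseEdge n (I Data.Product., J) =
  IsUpperIdeal n I × IsUpperIdeal n J × I ⊂ J ×
  (¬ Σ (Subset (N n)) λ K → IsUpperIdeal n K × I ⊂ K × K ⊂ J)

HasCardinality : {A : Set} → (A → Set) → ℕ → Set
HasCardinality {A} P k =
  Σ (List A) λ xs → Unique xs × length xs ≡ k × (∀ x → (Any (x ≡_) xs) ⇔ P x)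

module Submission where

-- Write each positive root as ε_a − ε_b + ε_(2n−b) (with ε_k = 0 for k ≥ n), where a < b and
-- a + b ≤ 2n.  Its rank r = b − a is its height and its lead a is the index of its first nonzero
-- coordinate; one root covers another exactly when its rank is one larger and the other's lead is
-- a or a + 1.  Placing the root (a, r) in column 2a + r + 1 of the strip 1 … 2n + 1 turns the root
-- poset into a triangle, and upper ideals correspond bijectively to ballot paths of length 2n + 1:
-- the ideal consists of the roots on or above the path.  An ideal I is covered by J exactly when
-- J = I ∪ {j} for a maximal root j outside I, and these roots sit at the peaks of height at least 2
-- of the path.  Counting such peaks over all ballot paths by recursion on the first step gives
-- 2n · C(2n − 1, n − 1) = (n + 1) · C(2n, n + 1).

module Lists where

  open import Data.Fin using (Fin; zero; suc; cast; toℕ)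
  open import Data.Fin.Properties using (toℕ-cast; toℕ-injective)
  open import Data.List using (List; []; _∷_; map; concatMap; allFin; length; lookup)
  open import Data.List.Properties using (length-map; length-++)
  open import Data.Nat using (_+_)
  open import Data.Nat.ListAction using (sum)
  open import Data.List.Membership.Propositional using (_∈_; find; lose)
  open import Data.List.Membership.Propositional.Properties using (∈-map⁻; ∈-concatMap⁻; ∈-concatMap⁺; ∈-allFin; ∈-lookup)
  import Data.List.Relation.Unary.All as All
  open import Data.List.Relation.Unary.Any using (here; there)
  open import Data.List.Relation.Unary.Unique.Propositional using (Unique; []; _∷_)
  import Data.List.Relation.Unary.Unique.Propositional.Properties as Unique
  open import Data.Empty using (⊥-elim)
  open import Data.Product using (Σ; _,_)
  open import Relation.Binary.PropositionalEquality using (_≡_; refl; sym; trans; cong)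

  private variable
    A B : Set
    xs : List A

  Unique-map⁺ : (f : A → B) → (∀ {x y} → x ∈ xs → y ∈ xs → f x ≡ f y → x ≡ y) → Unique xs → Unique (map f xs)
  Unique-map⁺ f inj [] = []
  Unique-map⁺ f inj (x∉xs ∷ u) =
    All.tabulate (λ fy∈ fx≡fy → let y , y∈ , fy≡ = ∈-map⁻ f fy∈ in
                   All.lookup x∉xs y∈ (inj (here refl) (there y∈) (trans fx≡fy fy≡)))
    ∷ Unique-map⁺ f (λ x∈ y∈ → inj (there x∈) (there y∈)) u

  Unique-concatMap⁺ : (f : A → List B) → (∀ {x} → x ∈ xs → Unique (f x)) →
    (∀ {x y z} → x ∈ xs → y ∈ xs → z ∈ f x → z ∈ f y → x ≡ y) → Unique xs → Unique (concatMap f xs)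
  Unique-concatMap⁺ f uf disj [] = []
  Unique-concatMap⁺ f uf disj (x∉xs ∷ u) =
    Unique.++⁺ (uf (here refl))
      (Unique-concatMap⁺ f (λ y∈ → uf (there y∈)) (λ x∈ y∈ → disj (there x∈) (there y∈)) u)
      (λ (z∈fx , z∈rest) → let y , y∈ , z∈fy = find (∈-concatMap⁻ f z∈rest) in
        All.lookup x∉xs y∈ (disj (here refl) (there y∈) z∈fx z∈fy))

  ∈-concatMap-allFin⁻ : ∀ {n} (f : Fin n → List A) {y} → y ∈ concatMap f (allFin n) → Σ (Fin n) λ i → y ∈ f i
  ∈-concatMap-allFin⁻ f y∈ = let i , _ , y∈fi = find (∈-concatMap⁻ f {allFin _} y∈) in i , y∈fi

  ∈-concatMap-allFin⁺ : ∀ {n} (f : Fin n → List A) {y} i → y ∈ f i → y ∈ concatMap f (allFin n)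
  ∈-concatMap-allFin⁺ f i y∈ = ∈-concatMap⁺ f (lose (∈-allFin i) y∈)

  lookup-map : (f : A → B) (ys : List A) (i : Fin (length (map f ys))) →
    lookup (map f ys) i ≡ f (lookup ys (cast (length-map f ys) i))
  lookup-map f (y ∷ ys) zero    = refl
  lookup-map f (y ∷ ys) (suc i) = lookup-map f ys i

  module _ (f : A → B) {xs : List B} {ys : List A} (xs≡ : xs ≡ map f ys) where

    reindex : Fin (length xs) → Fin (length ys)
    reindex = cast (trans (cong length xs≡) (length-map f ys))

    reindex-injective : ∀ {i j} → reindex i ≡ reindex j → i ≡ j
    reindex-injective {i} {j} e = toℕ-injective (trans (sym (toℕ-cast _ i)) (trans (cong toℕ e) (toℕ-cast _ j)))

    reindex-surjective : ∀ j → Σ (Fin (length xs)) λ i → reindex i ≡ j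
    reindex-surjective j = cast (sym length≡) j ,
      toℕ-injective (trans (toℕ-cast length≡ (cast (sym length≡) j)) (toℕ-cast (sym length≡) j))
      where length≡ = trans (cong length xs≡) (length-map f ys)

  lookup-reindex : (f : A → B) {xs : List B} {ys : List A} (xs≡ : xs ≡ map f ys) →
    ∀ i → lookup xs i ≡ f (lookup ys (reindex f xs≡ i))
  lookup-reindex f {ys = ys} refl = lookup-map f ys

  lookup-injective : ∀ {xs : List A} → Unique xs → ∀ {i j} → lookup xs i ≡ lookup xs j → i ≡ j
  lookup-injective {xs = x ∷ xs} _          {zero}  {zero}  _ = refl
  lookup-injective               (x∉xs ∷ _) {zero}  {suc j} e = ⊥-elim (All.lookup x∉xs (∈-lookup j) e)
  lookup-injective               (x∉xs ∷ _) {suc i} {zero}  e = ⊥-elim (All.lookup x∉xs (∈-lookup i) (sym e))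
  lookup-injective               (_ ∷ u)    {suc i} {suc j} e = cong suc (lookup-injective u e)

  length-concatMap : (f : A → List B) (xs : List A) → length (concatMap f xs) ≡ sum (map (λ x → length (f x)) xs)
  length-concatMap f []       = refl
  length-concatMap f (x ∷ xs) = trans (length-++ (f x)) (cong (length (f x) +_) (length-concatMap f xs))

module UpperSets where

  open import Data.Empty using (⊥-elim)
  open import Data.Fin using (Fin)
  open import Data.Fin.Subset using (Subset; _∈_; _∉_; _⊆_; _⊂_; _∪_; ⁅_⁆)
  open import Data.Fin.Subset.Properties using (x∈p∪q⁻; p⊆p∪q; q⊆p∪q; x∈⁅x⁆; x∈⁅y⁆⇒x≡y; ⊆-antisym; _∈?_)
  open import Data.List using (allFin; filter)
  open import Data.List.Extrema.Nat using (argmax; argmax-all; v≤f[argmax]⁺)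
  open import Data.List.Membership.Propositional using (lose)
  open import Data.List.Membership.Propositional.Properties using (∈-filter⁺; ∈-filter⁻; ∈-allFin)
  import Data.List.Relation.Unary.All as All
  open import Data.Nat using (ℕ; _<_)
  open import Data.Nat.Properties using (≤-refl; <⇒≱)
  open import Data.Product using (Σ; _,_; _×_; proj₁; proj₂)
  open import Data.Sum using (inj₁; inj₂)
  open import Relation.Binary.Construct.Closure.ReflexiveTransitive using (Star; ε; _◅_)
  open import Relation.Binary.PropositionalEquality using (_≡_; refl; sym; trans)
  import Data.Vec as Vec
  import Data.Vec.Properties as Vec
  open import Relation.Nullary using (¬_; Dec; does; yes; no)
  open import Relation.Nullary.Decidable using (_×-dec_; ¬?; dec-true)

  subsetOf : ∀ {m} {P : Fin m → Set} → (∀ j → Dec (P j)) → Subset m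
  subsetOf P? = Vec.tabulate (λ j → does (P? j))

  module _ {m} {P : Fin m → Set} (P? : ∀ j → Dec (P j)) where

    ∈-subsetOf⁺ : ∀ {j} → P j → j ∈ subsetOf P?
    ∈-subsetOf⁺ {j} pj = Vec.lookup⇒[]= j _ (trans (Vec.lookup∘tabulate _ j) (dec-true (P? j) pj))

    ∈-subsetOf⁻ : ∀ {j} → j ∈ subsetOf P? → P j
    ∈-subsetOf⁻ {j} j∈ with P? j | trans (sym (Vec.lookup∘tabulate (λ j → does (P? j)) j)) (Vec.[]=⇒lookup j∈)
    ... | yes pj | _ = pj

  x∉p∧x∈p∪⁅y⁆⇒x≡y : ∀ {m} {p : Subset m} {x y} → x ∉ p → x ∈ p ∪ ⁅ y ⁆ → x ≡ y
  x∉p∧x∈p∪⁅y⁆⇒x≡y {p = p} {x} {y} x∉p x∈ with x∈p∪q⁻ p ⁅ y ⁆ x∈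
  ... | inj₁ x∈p   = ⊥-elim (x∉p x∈p)
  ... | inj₂ x∈⁅y⁆ = x∈⁅y⁆⇒x≡y y x∈⁅y⁆

  module _ {m : ℕ} (_⋗_ : Fin m → Fin m → Set) where

    IsUpperSet : Subset m → Set
    IsUpperSet I = ∀ a b → b ∈ I → Star _⋗_ a b → a ∈ I

    IsUpperSetCover : Subset m × Subset m → Set
    IsUpperSetCover (I , J) =
      IsUpperSet I × IsUpperSet J × I ⊂ J × ¬ Σ (Subset m) λ K → IsUpperSet K × I ⊂ K × K ⊂ J

    IsMaximalOutside : Subset m → Fin m → Set
    IsMaximalOutside I i = i ∉ I × (∀ p → p ⋗ i → p ∈ I)

    ⋗-closed⇒IsUpperSet : ∀ {I} → (∀ a b → b ∈ I → a ⋗ b → a ∈ I) → IsUpperSet I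
    ⋗-closed⇒IsUpperSet closed a b b∈I ε           = b∈I
    ⋗-closed⇒IsUpperSet closed a b b∈I (a⋗c ◅ c≥b) = closed a _ (⋗-closed⇒IsUpperSet closed _ b b∈I c≥b) a⋗c

    IsUpperSet⇒⋗-closed : ∀ {I} → IsUpperSet I → ∀ a b → b ∈ I → a ⋗ b → a ∈ I
    IsUpperSet⇒⋗-closed upper a b b∈I a⋗b = upper a b b∈I (a⋗b ◅ ε)

    ∪⁅⁆-IsUpperSet : ∀ {I i} → IsUpperSet I → (∀ p → p ⋗ i → p ∈ I) → IsUpperSet (I ∪ ⁅ i ⁆)
    ∪⁅⁆-IsUpperSet {I} {i} upper above-i = ⋗-closed⇒IsUpperSet closed
      where
        closed : ∀ a b → b ∈ I ∪ ⁅ i ⁆ → a ⋗ b → a ∈ I ∪ ⁅ i ⁆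
        closed a b b∈ a⋗b with x∈p∪q⁻ I ⁅ i ⁆ b∈
        ... | inj₁ b∈I   = p⊆p∪q ⁅ i ⁆ (IsUpperSet⇒⋗-closed upper a b b∈I a⋗b)
        ... | inj₂ b∈⁅i⁆ with refl ← x∈⁅y⁆⇒x≡y i b∈⁅i⁆ = p⊆p∪q ⁅ i ⁆ (above-i a a⋗b)

    IsMaximalOutside⇒IsUpperSetCover : ∀ {I i} → IsUpperSet I → IsMaximalOutside I i → IsUpperSetCover (I , I ∪ ⁅ i ⁆)
    IsMaximalOutside⇒IsUpperSetCover {I} {i} upper (i∉I , above-i) =
      upper , ∪⁅⁆-IsUpperSet upper above-i , (p⊆p∪q ⁅ i ⁆ , i , q⊆p∪q I ⁅ i ⁆ (x∈⁅x⁆ i) , i∉I) , no-between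
      where
        no-between : ¬ Σ (Subset m) λ K → IsUpperSet K × I ⊂ K × K ⊂ I ∪ ⁅ i ⁆
        no-between (K , _ , (I⊆K , x , x∈K , x∉I) , (K⊆J , y , y∈J , y∉K))
          with x∈p∪q⁻ I ⁅ i ⁆ (K⊆J x∈K) | x∈p∪q⁻ I ⁅ i ⁆ y∈J
        ... | inj₁ x∈I   | _          = x∉I x∈I
        ... | inj₂ _     | inj₁ y∈I   = y∉K (I⊆K y∈I)
        ... | inj₂ x∈⁅i⁆ | inj₂ y∈⁅i⁆
          with refl ← x∈⁅y⁆⇒x≡y i x∈⁅i⁆ | refl ← x∈⁅y⁆⇒x≡y i y∈⁅i⁆ = y∉K x∈K

    module _ (rank : Fin m → ℕ) (⋗-rank : ∀ {a b} → a ⋗ b → rank b < rank a) where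

      -- A new element of maximal rank in J has all its upper covers already in I.
      IsUpperSetCover⇒IsMaximalOutside : ∀ {I J} → IsUpperSetCover (I , J) →
        Σ (Fin m) λ i → IsMaximalOutside I i × J ≡ I ∪ ⁅ i ⁆
      IsUpperSetCover⇒IsMaximalOutside {I} {J} (upper-I , upper-J , (I⊆J , x , x∈J , x∉I) , no-between) =
        i , (i∉I , above-i) , ⊆-antisym J⊆K K⊆J
        where
          new? = λ j → (j ∈? J) ×-dec ¬? (j ∈? I)
          new = filter new? (allFin m)
          i = argmax rank x new
          i∈J×i∉I = argmax-all rank {xs = new} (x∈J , x∉I) (All.tabulate λ j∈ → proj₂ (∈-filter⁻ new? {xs = allFin m} j∈))
          i∉I = proj₂ i∈J×i∉I
          i∈J = proj₁ i∈J×i∉I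
          above-i : ∀ p → p ⋗ i → p ∈ I
          above-i p p⋗i with p ∈? I
          ... | yes p∈I = p∈I
          ... | no  p∉I = ⊥-elim (<⇒≱ (⋗-rank p⋗i)
            (v≤f[argmax]⁺ x new (inj₂ (lose (∈-filter⁺ new? (∈-allFin p) (IsUpperSet⇒⋗-closed upper-J p i i∈J p⋗i , p∉I)) ≤-refl))))
          K = I ∪ ⁅ i ⁆
          K⊆J : K ⊆ J
          K⊆J y∈K with x∈p∪q⁻ I ⁅ i ⁆ y∈K
          ... | inj₁ y∈I   = I⊆J y∈I
          ... | inj₂ y∈⁅i⁆ with refl ← x∈⁅y⁆⇒x≡y i y∈⁅i⁆ = i∈J
          J⊆K : J ⊆ K
          J⊆K {y} y∈J with y ∈? K
          ... | yes y∈K = y∈K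
          ... | no  y∉K = ⊥-elim (no-between (K , ∪⁅⁆-IsUpperSet upper-I above-i ,
                            (p⊆p∪q ⁅ i ⁆ , i , q⊆p∪q I ⁅ i ⁆ (x∈⁅x⁆ i) , i∉I) , (K⊆J , y , y∈J , y∉K)))

module PeakCounting where

  open import Data.Bool using (Bool; true; false)
  open import Data.List using (List; []; _∷_; [_]; _++_; map; length)
  open import Data.List.Properties using (length-++; length-map; map-++)
  open import Data.Nat
  open import Data.Nat.Properties
  open import Data.Nat.Combinatorics using (_C_; nCk+nC[k+1]≡[n+1]C[k+1]; k>n⇒nCk≡0; nCk≡nC[n∸k])
  open import Data.Nat.ListAction using (sum)
  open import Data.Nat.ListAction.Properties using (sum-++)
  open import Data.Nat.Tactic.RingSolver using (solve-∀)
  open import Relation.Binary.PropositionalEquality using (_≡_; refl; sym; trans; cong; cong₂; subst; module ≡-Reasoning)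

  -- Paths are words over {true = up, false = down}; ballotPaths L h lists those of length L that
  -- start at height h and never go below 0.
  ballotPaths : ℕ → ℕ → List (List Bool)
  ballotPaths zero    h       = [ [] ]
  ballotPaths (suc L) zero    = map (true ∷_) (ballotPaths L 1)
  ballotPaths (suc L) (suc h) =
    map (true ∷_) (ballotPaths L (suc (suc h))) ++ map (false ∷_) (ballotPaths L h)

  ballotCount : ℕ → ℕ → ℕ
  ballotCount L h = length (ballotPaths L h)

  ballotCount-suc-zero : ∀ L → ballotCount (suc L) 0 ≡ ballotCount L 1
  ballotCount-suc-zero L = length-map (true ∷_) (ballotPaths L 1)

  ballotCount-suc : ∀ L h → ballotCount (suc L) (suc h) ≡ ballotCount L (suc (suc h)) + ballotCount L h
  ballotCount-suc L h = trans (length-++ (map (true ∷_) (ballotPaths L (suc (suc h)))))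
    (cong₂ _+_ (length-map (true ∷_) (ballotPaths L (suc (suc h)))) (length-map (false ∷_) (ballotPaths L h)))

  -- peaks h up p lists the positions of the peaks of height ≥ 2 of p started at height h, where a
  -- peak is preceded by an up step and followed by a down step or by the end of p; the flag up
  -- tells whether the step before position 0 was an up step.
  initialPeak : Bool → ℕ → List ℕ
  initialPeak true (suc (suc h)) = [ 0 ]
  initialPeak _    _             = []

  peaks : ℕ → Bool → List Bool → List ℕ
  peaks h       up []          = initialPeak up h
  peaks h       up (true ∷ p)  = map suc (peaks (suc h) true p)
  peaks zero    up (false ∷ p) = []
  peaks (suc h) up (false ∷ p) = initialPeak up (suc h) ++ map suc (peaks h false p)

  peakCount : List (List Bool) → ℕ → Bool → ℕ
  peakCount ps h up = sum (map (λ p → length (peaks h up p)) ps)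

  peakTotal : ℕ → ℕ → Bool → ℕ
  peakTotal L h up = peakCount (ballotPaths L h) h up

  peakCount-++ : ∀ ps qs h up → peakCount (ps ++ qs) h up ≡ peakCount ps h up + peakCount qs h up
  peakCount-++ ps qs h up = begin
    sum (map _ (ps ++ qs))         ≡⟨ cong sum (map-++ _ ps qs) ⟩
    sum (map _ ps ++ map _ qs)     ≡⟨ sum-++ (map _ ps) _ ⟩
    peakCount ps h up + peakCount qs h up ∎
    where open ≡-Reasoning

  peakCount-up : ∀ ps h up → peakCount (map (true ∷_) ps) h up ≡ peakCount ps (suc h) true
  peakCount-up []       h up = refl
  peakCount-up (p ∷ ps) h up = cong₂ _+_ (length-map suc (peaks (suc h) true p)) (peakCount-up ps h up)

  peakCount-down : ∀ ps h up → peakCount (map (false ∷_) ps) (suc h) up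
                   ≡ length (initialPeak up (suc h)) * length ps + peakCount ps h false
  peakCount-down [] h up = sym (cong (_+ 0) (*-zeroʳ (length (initialPeak up (suc h)))))
  peakCount-down (p ∷ ps) h up = begin
    length (initialPeak up (suc h) ++ map suc (peaks h false p)) + peakCount (map (false ∷_) ps) (suc h) up
      ≡⟨ cong₂ _+_ (trans (length-++ (initialPeak up (suc h))) (cong (c +_) (length-map suc (peaks h false p))))
                   (peakCount-down ps h up) ⟩
    (c + length (peaks h false p)) + (c * length ps + peakCount ps h false)
      ≡⟨ shuffle c (length (peaks h false p)) (length ps) (peakCount ps h false) ⟩
    c * suc (length ps) + (length (peaks h false p) + peakCount ps h false) ∎
    where
      open ≡-Reasoning
      c = length (initialPeak up (suc h))
      shuffle : ∀ c e l s → (c + e) + (c * l + s) ≡ c * (1 + l) + (e + s)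
      shuffle = solve-∀

  peakTotal-suc-zero : ∀ L up → peakTotal (suc L) 0 up ≡ peakTotal L 1 true
  peakTotal-suc-zero L up = peakCount-up (ballotPaths L 1) 0 up

  peakTotal-suc : ∀ L h up → peakTotal (suc L) (suc h) up ≡
    peakTotal L (suc (suc h)) true + (length (initialPeak up (suc h)) * ballotCount L h + peakTotal L h false)
  peakTotal-suc L h up =
    trans (peakCount-++ (map (true ∷_) (ballotPaths L (suc (suc h)))) _ (suc h) up)
          (cong₂ _+_ (peakCount-up (ballotPaths L (suc (suc h))) (suc h) up)
                     (peakCount-down (ballotPaths L h) h up))

  peakTotal-entered-up-low : ∀ L → peakTotal (suc L) 1 true ≡ peakTotal (suc L) 1 false
  peakTotal-entered-up-low L = trans (peakTotal-suc L 0 true) (sym (peakTotal-suc L 0 false))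

  peakTotal-entered-up-high : ∀ L h →
    peakTotal (suc L) (suc (suc h)) true ≡ peakTotal (suc L) (suc (suc h)) false + ballotCount L (suc h)
  peakTotal-entered-up-high L h = begin
    peakTotal (suc L) (suc (suc h)) true       ≡⟨ peakTotal-suc L (suc h) true ⟩
    a + ((b + 0) + w)                           ≡⟨ shuffle a b w ⟩
    (a + (0 * b + w)) + b                       ≡⟨ cong (_+ b) (peakTotal-suc L (suc h) false) ⟨
    peakTotal (suc L) (suc (suc h)) false + b  ∎
    where
      open ≡-Reasoning
      a = peakTotal L (suc (suc (suc h))) true
      b = ballotCount L (suc h)
      w = peakTotal L (suc h) false
      shuffle : ∀ a b w → a + ((b + 0) + w) ≡ (a + (0 * b + w)) + b
      shuffle = solve-∀

  ballotCountBelow : ℕ → ℕ → ℕ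
  ballotCountBelow L zero    = 0
  ballotCountBelow L (suc h) = ballotCount L h

  ballotCount-step : ∀ L h → ballotCount (suc L) h ≡ ballotCount L (suc h) + ballotCountBelow L h
  ballotCount-step L zero    = trans (ballotCount-suc-zero L) (sym (+-identityʳ _))
  ballotCount-step L (suc h) = ballotCount-suc L h

  peakTotal-closed : ∀ L h → peakTotal (suc (suc L)) h false ≡ suc L * ballotCount L h + ballotCountBelow (suc L) h
  peakTotal-closed zero zero = refl
  peakTotal-closed zero (suc zero) = refl
  peakTotal-closed zero (suc (suc h)) = refl
  peakTotal-closed (suc L) zero = begin
    peakTotal (3 + L) 0 false                   ≡⟨ peakTotal-suc-zero (suc (suc L)) false ⟩
    peakTotal (2 + L) 1 true                    ≡⟨ peakTotal-entered-up-low (suc L) ⟩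
    peakTotal (2 + L) 1 false                   ≡⟨ peakTotal-closed L 1 ⟩
    suc L * ballotCount L 1 + ballotCount (suc L) 0
                                                ≡⟨ cong (suc L * ballotCount L 1 +_) (ballotCount-suc-zero L) ⟩
    suc L * ballotCount L 1 + ballotCount L 1   ≡⟨ +-comm (suc L * ballotCount L 1) _ ⟩
    suc (suc L) * ballotCount L 1               ≡⟨ cong (suc (suc L) *_) (ballotCount-suc-zero L) ⟨
    suc (suc L) * ballotCount (suc L) 0         ≡⟨ +-identityʳ _ ⟨
    suc (suc L) * ballotCount (suc L) 0 + 0     ∎
    where open ≡-Reasoning
  peakTotal-closed (suc L) (suc h) = begin
    peakTotal (3 + L) (suc h) false
      ≡⟨ peakTotal-suc (suc (suc L)) h false ⟩
    peakTotal (2 + L) (2 + h) true + (0 * ballotCount (2 + L) h + peakTotal (2 + L) h false)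
      ≡⟨ cong₂ _+_ (peakTotal-entered-up-high (suc L) h) refl ⟩
    (peakTotal (2 + L) (2 + h) false + ballotCount (suc L) (suc h)) + peakTotal (2 + L) h false
      ≡⟨ cong₂ _+_ (cong (_+ ballotCount (suc L) (suc h)) (peakTotal-closed L (suc (suc h)))) (peakTotal-closed L h) ⟩
    ((suc L * a + ballotCount (suc L) (suc h)) + ballotCount (suc L) (suc h)) + (suc L * b + ballotCountBelow (suc L) h)
      ≡⟨ cong (λ z → ((suc L * a + z) + z) + (suc L * b + ballotCountBelow (suc L) h)) (ballotCount-suc L h) ⟩
    ((suc L * a + (a + b)) + (a + b)) + (suc L * b + ballotCountBelow (suc L) h)
      ≡⟨ shuffle (suc L) a b (ballotCountBelow (suc L) h) ⟩
    suc (suc L) * (a + b) + ((a + b) + ballotCountBelow (suc L) h)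
      ≡⟨ cong₂ _+_ (cong (suc (suc L) *_) (sym (ballotCount-suc L h)))
                   (trans (cong (_+ ballotCountBelow (suc L) h) (sym (ballotCount-suc L h))) (sym (ballotCount-step (suc L) h))) ⟩
    suc (suc L) * ballotCount (suc L) (suc h) + ballotCount (suc (suc L)) h ∎
    where
      open ≡-Reasoning
      a = ballotCount L (suc (suc h))
      b = ballotCount L h
      shuffle : ∀ k a b d → ((k * a + (a + b)) + (a + b)) + (k * b + d) ≡ (1 + k) * (a + b) + ((a + b) + d)
      shuffle = solve-∀

  partialRowSum : ℕ → ℕ → ℕ
  partialRowSum L zero    = 0
  partialRowSum L (suc k) = partialRowSum L k + L C k

  partialRowSum-pascal : ∀ L k → partialRowSum (suc L) (suc k) ≡ partialRowSum L (suc k) + partialRowSum L k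
  partialRowSum-pascal L zero    = refl
  partialRowSum-pascal L (suc k) = begin
    partialRowSum (suc L) (suc k) + suc L C suc k
      ≡⟨ cong₂ _+_ (partialRowSum-pascal L k) (sym (nCk+nC[k+1]≡[n+1]C[k+1] L k)) ⟩
    (partialRowSum L (suc k) + partialRowSum L k) + (L C k + L C suc k)
      ≡⟨ shuffle (partialRowSum L (suc k)) (partialRowSum L k) (L C k) (L C suc k) ⟩
    (partialRowSum L (suc k) + L C suc k) + (partialRowSum L k + L C k) ∎
    where
      open ≡-Reasoning
      shuffle : ∀ a b c d → (a + b) + (c + d) ≡ (a + d) + (b + c)
      shuffle = solve-∀

  ballotCount-short : ∀ L h → L ≤ h → ballotCount L h ≡ partialRowSum L (suc L)
  ballotCount-short zero    h       _         = refl
  ballotCount-short (suc L) (suc h) (s≤s L≤h) = begin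
    ballotCount (suc L) (suc h)
      ≡⟨ ballotCount-suc L h ⟩
    ballotCount L (suc (suc h)) + ballotCount L h
      ≡⟨ cong₂ _+_ (ballotCount-short L (suc (suc h)) (m≤n⇒m≤1+n (m≤n⇒m≤1+n L≤h))) (ballotCount-short L h L≤h) ⟩
    partialRowSum L (suc L) + partialRowSum L (suc L)
      ≡⟨ cong (_+ partialRowSum L (suc L)) (trans (cong (partialRowSum L (suc L) +_) (k>n⇒nCk≡0 (n<1+n L))) (+-identityʳ _)) ⟨
    partialRowSum L (suc (suc L)) + partialRowSum L (suc L)
      ≡⟨ partialRowSum-pascal L (suc L) ⟨
    partialRowSum (suc L) (suc (suc L)) ∎
    where open ≡-Reasoning

  ballotCount-odd : ∀ q h L → L ≡ q + q + h →
    ballotCount (suc L) h + partialRowSum (suc L) q ≡ partialRowSum (suc L) (suc (q + h))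
  ballotCount-odd zero zero L refl = refl
  ballotCount-odd zero (suc h) L refl = begin
    ballotCount (2 + h) (suc h) + 0
      ≡⟨ +-identityʳ _ ⟩
    ballotCount (2 + h) (suc h)
      ≡⟨ ballotCount-suc (suc h) h ⟩
    ballotCount (suc h) (2 + h) + ballotCount (suc h) h
      ≡⟨ cong₂ _+_ (ballotCount-short (suc h) (2 + h) (n≤1+n (suc h)))
                   (trans (sym (+-identityʳ _)) (ballotCount-odd zero h h refl)) ⟩
    partialRowSum (suc h) (2 + h) + partialRowSum (suc h) (suc h)
      ≡⟨ partialRowSum-pascal (suc h) (suc h) ⟨
    partialRowSum (2 + h) (2 + h) ∎
    where open ≡-Reasoning
  ballotCount-odd (suc q) zero L e =
    subst (λ L → ballotCount (suc L) 0 + partialRowSum (suc L) (suc q) ≡ partialRowSum (suc L) (suc (suc q + 0)))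
          (sym (trans e (index q))) (begin
    ballotCount (2 + X) 0 + partialRowSum (2 + X) (suc q)
      ≡⟨ cong₂ _+_ (ballotCount-suc-zero (suc X)) (partialRowSum-pascal (suc X) q) ⟩
    ballotCount (suc X) 1 + (partialRowSum (suc X) (suc q) + partialRowSum (suc X) q)
      ≡⟨ shuffle (ballotCount (suc X) 1) (partialRowSum (suc X) (suc q)) (partialRowSum (suc X) q) ⟩
    (ballotCount (suc X) 1 + partialRowSum (suc X) q) + partialRowSum (suc X) (suc q)
      ≡⟨ cong (_+ partialRowSum (suc X) (suc q))
              (trans (ballotCount-odd q 1 X refl) (cong (λ z → partialRowSum (suc X) (suc z)) (+-comm q 1))) ⟩
    partialRowSum (suc X) (2 + q) + partialRowSum (suc X) (suc q)
      ≡⟨ partialRowSum-pascal (suc X) (suc q) ⟨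
    partialRowSum (2 + X) (2 + q)
      ≡⟨ cong (λ z → partialRowSum (2 + X) (suc z)) (+-identityʳ (suc q)) ⟨
    partialRowSum (2 + X) (suc (suc q + 0)) ∎)
    where
      open ≡-Reasoning
      X = q + q + 1
      index : ∀ q → suc q + suc q + 0 ≡ suc (q + q + 1)
      index = solve-∀
      shuffle : ∀ a b c → a + (b + c) ≡ (a + c) + b
      shuffle = solve-∀
  ballotCount-odd (suc q) (suc h) L e =
    subst (λ L → ballotCount (suc L) (suc h) + partialRowSum (suc L) (suc q) ≡ partialRowSum (suc L) (suc (suc q + suc h)))
          (sym (trans e (index q h))) (begin
    ballotCount (2 + X) (suc h) + partialRowSum (2 + X) (suc q)
      ≡⟨ cong₂ _+_ (ballotCount-suc (suc X) h) (partialRowSum-pascal (suc X) q) ⟩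
    (ballotCount (suc X) (2 + h) + ballotCount (suc X) h) + (partialRowSum (suc X) (suc q) + partialRowSum (suc X) q)
      ≡⟨ shuffle (ballotCount (suc X) (2 + h)) (ballotCount (suc X) h) (partialRowSum (suc X) q) (partialRowSum (suc X) (suc q)) ⟩
    (ballotCount (suc X) (2 + h) + partialRowSum (suc X) q) + (ballotCount (suc X) h + partialRowSum (suc X) (suc q))
      ≡⟨ cong₂ _+_ (trans (ballotCount-odd q (2 + h) X (index₁ q h)) (cong (partialRowSum (suc X)) (index₂ q h)))
                   (trans (ballotCount-odd (suc q) h X (index₃ q h)) (cong (partialRowSum (suc X)) (index₄ q h))) ⟩
    partialRowSum (suc X) (suc (suc q + suc h)) + partialRowSum (suc X) (suc q + suc h)
      ≡⟨ partialRowSum-pascal (suc X) (suc q + suc h) ⟨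
    partialRowSum (2 + X) (suc (suc q + suc h)) ∎)
    where
      open ≡-Reasoning
      X = suc (q + q + suc h)
      index : ∀ q h → suc q + suc q + suc h ≡ suc (suc (q + q + suc h))
      index = solve-∀
      index₁ : ∀ q h → suc (q + q + suc h) ≡ q + q + (2 + h)
      index₁ = solve-∀
      index₂ : ∀ q h → suc (q + (2 + h)) ≡ suc (suc q + suc h)
      index₂ = solve-∀
      index₃ : ∀ q h → suc (q + q + suc h) ≡ suc q + suc q + h
      index₃ = solve-∀
      index₄ : ∀ q h → suc (suc q + h) ≡ suc q + suc h
      index₄ = solve-∀
      shuffle : ∀ a b f₀ f₁ → (a + b) + (f₁ + f₀) ≡ (a + f₀) + (b + f₁)
      shuffle = solve-∀

  ballotCount-odd-from-zero : ∀ m → ballotCount (suc (m + m)) 0 ≡ suc (m + m) C m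
  ballotCount-odd-from-zero m = +-cancelʳ-≡ (partialRowSum (suc (m + m)) m) _ _ (begin
    ballotCount (suc (m + m)) 0 + partialRowSum (suc (m + m)) m
      ≡⟨ ballotCount-odd m 0 (m + m) (sym (+-identityʳ (m + m))) ⟩
    partialRowSum (suc (m + m)) (suc (m + 0))
      ≡⟨ cong (λ k → partialRowSum (suc (m + m)) (suc k)) (+-identityʳ m) ⟩
    partialRowSum (suc (m + m)) m + suc (m + m) C m
      ≡⟨ +-comm (partialRowSum (suc (m + m)) m) _ ⟩
    suc (m + m) C m + partialRowSum (suc (m + m)) m ∎)
    where open ≡-Reasoning

  [1+k]*[1+n]C[1+k]≡[1+n]*nCk : ∀ n k → suc k * (suc n C suc k) ≡ suc n * (n C k)
  [1+k]*[1+n]C[1+k]≡[1+n]*nCk zero zero = refl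
  [1+k]*[1+n]C[1+k]≡[1+n]*nCk zero (suc k) = begin
    suc (suc k) * (1 C suc (suc k)) ≡⟨ cong (suc (suc k) *_) (k>n⇒nCk≡0 {1} {suc (suc k)} (s≤s (s≤s z≤n))) ⟩
    suc (suc k) * 0                 ≡⟨ *-zeroʳ (suc (suc k)) ⟩
    0                               ≡⟨ cong (1 *_) (k>n⇒nCk≡0 {0} {suc k} (s≤s z≤n)) ⟨
    1 * (0 C suc k)                 ∎
    where open ≡-Reasoning
  [1+k]*[1+n]C[1+k]≡[1+n]*nCk (suc n) zero = begin
    1 * (suc (suc n) C 1)   ≡⟨ cong (1 *_) (nCk+nC[k+1]≡[n+1]C[k+1] (suc n) 0) ⟨
    1 * (1 + suc n C 1)     ≡⟨ cong (λ z → 1 * (1 + z)) (trans (sym (*-identityˡ _)) ([1+k]*[1+n]C[1+k]≡[1+n]*nCk n 0)) ⟩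
    1 * (1 + suc n * 1)     ≡⟨ shuffle n ⟩
    suc (suc n) * 1         ∎
    where
      open ≡-Reasoning
      shuffle : ∀ n → 1 * (1 + (1 + n) * 1) ≡ (2 + n) * 1
      shuffle = solve-∀
  [1+k]*[1+n]C[1+k]≡[1+n]*nCk (suc n) (suc k) = begin
    suc (suc k) * (suc (suc n) C suc (suc k))
      ≡⟨ cong (suc (suc k) *_) (nCk+nC[k+1]≡[n+1]C[k+1] (suc n) (suc k)) ⟨
    suc (suc k) * (c₁ + c₂)
      ≡⟨ shuffle₁ (suc k) c₁ c₂ ⟩
    (suc k * c₁ + c₁) + suc (suc k) * c₂
      ≡⟨ cong₂ _+_ (cong (_+ c₁) ([1+k]*[1+n]C[1+k]≡[1+n]*nCk n k)) ([1+k]*[1+n]C[1+k]≡[1+n]*nCk n (suc k)) ⟩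
    (suc n * (n C k) + c₁) + suc n * (n C suc k)
      ≡⟨ shuffle₂ (suc n) (n C k) c₁ (n C suc k) ⟩
    c₁ + suc n * (n C k + n C suc k)
      ≡⟨ cong (λ z → c₁ + suc n * z) (nCk+nC[k+1]≡[n+1]C[k+1] n k) ⟩
    c₁ + suc n * c₁ ∎
    where
      open ≡-Reasoning
      c₁ = suc n C suc k
      c₂ = suc n C suc (suc k)
      shuffle₁ : ∀ k a b → (1 + k) * (a + b) ≡ (k * a + a) + (1 + k) * b
      shuffle₁ = solve-∀
      shuffle₂ : ∀ m x y z → (m * x + y) + m * z ≡ y + m * (x + z)
      shuffle₂ = solve-∀

  [1+n]*2nC[1+n]≡n*2nCn : ∀ n → suc n * ((n + n) C suc n) ≡ n * ((n + n) C n)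
  [1+n]*2nC[1+n]≡n*2nCn zero = refl
  [1+n]*2nC[1+n]≡n*2nCn (suc m) = begin
    suc (suc m) * ((suc m + suc m) C suc (suc m))
      ≡⟨ cong (λ z → suc (suc m) * (suc z C suc (suc m))) (+-suc m m) ⟩
    suc (suc m) * (suc (suc (m + m)) C suc (suc m))
      ≡⟨ [1+k]*[1+n]C[1+k]≡[1+n]*nCk (suc (m + m)) (suc m) ⟩
    suc (suc (m + m)) * (suc (m + m) C suc m)
      ≡⟨ cong (suc (suc (m + m)) *_) (trans (nCk≡nC[n∸k] (s≤s (m≤m+n m m))) (cong (suc (m + m) C_) (m+n∸n≡m m m))) ⟩
    suc (suc (m + m)) * (suc (m + m) C m)
      ≡⟨ [1+k]*[1+n]C[1+k]≡[1+n]*nCk (suc (m + m)) m ⟨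
    suc m * (suc (suc (m + m)) C suc m)
      ≡⟨ cong (λ z → suc m * (suc z C suc m)) (+-suc m m) ⟨
    suc m * ((suc m + suc m) C suc m) ∎
    where open ≡-Reasoning

  peakTotal-formula : ∀ n → peakTotal (suc (n + n)) 0 false ≡ suc n * ((n + n) C suc n)
  peakTotal-formula zero = refl
  peakTotal-formula (suc m) = begin
    peakTotal (suc (suc m + suc m)) 0 false
      ≡⟨ cong (λ z → peakTotal (suc (suc z)) 0 false) (+-suc m m) ⟩
    peakTotal (suc (suc (suc (m + m)))) 0 false
      ≡⟨ peakTotal-closed (suc (m + m)) 0 ⟩
    suc (suc (m + m)) * ballotCount (suc (m + m)) 0 + 0
      ≡⟨ +-identityʳ _ ⟩
    suc (suc (m + m)) * ballotCount (suc (m + m)) 0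
      ≡⟨ cong (suc (suc (m + m)) *_) (ballotCount-odd-from-zero m) ⟩
    suc (suc (m + m)) * (suc (m + m) C m)
      ≡⟨ cong (suc (suc (m + m)) *_) (trans (nCk≡nC[n∸k] (m≤n⇒m≤1+n (m≤m+n m m))) (cong (suc (m + m) C_) (1+m+m∸m≡1+m m))) ⟩
    suc (suc (m + m)) * (suc (m + m) C suc m)
      ≡⟨ [1+k]*[1+n]C[1+k]≡[1+n]*nCk (suc (m + m)) (suc m) ⟨
    suc (suc m) * (suc (suc (m + m)) C suc (suc m))
      ≡⟨ cong (λ z → suc (suc m) * (suc z C suc (suc m))) (+-suc m m) ⟨
    suc (suc m) * ((suc m + suc m) C suc (suc m)) ∎
    where
      open ≡-Reasoning
      1+m+m∸m≡1+m : ∀ m → suc (m + m) ∸ m ≡ suc m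
      1+m+m∸m≡1+m m = trans (+-∸-assoc 1 (m≤n+m m m)) (cong suc (m+n∸n≡m m m))

module BallotPaths where

  open PeakCounting
  open Lists

  open import Data.Bool using (Bool; true; false)
  open import Data.Empty using (⊥; ⊥-elim)
  open import Data.List using (List; []; _∷_; map; length)
  open import Data.List.Membership.Propositional using (_∈_)
  open import Data.List.Membership.Propositional.Properties using (∈-map⁺; ∈-map⁻; ∈-++⁺ˡ; ∈-++⁺ʳ; ∈-++⁻)
  open import Data.List.Relation.Unary.Any using (here)
  open import Data.List.Relation.Unary.Unique.Propositional using (Unique; []; _∷_)
  import Data.List.Relation.Unary.Unique.Propositional.Properties as Unique
  import Data.List.Relation.Unary.All as All
  open import Data.List.Properties using (∷-injectiveʳ)
  open import Data.Nat
  open import Data.Nat.Properties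
  open import Data.Product using (_,_; _×_)
  open import Data.Sum using (_⊎_; inj₁; inj₂)
  import Data.Sum as Sum
  open import Data.Unit using (⊤; tt)
  open import Relation.Binary.PropositionalEquality using (_≡_; refl; sym; trans; cong; module ≡-Reasoning)

  -- A down step at height 0 stays at 0; this only happens off ballot paths.
  heightAt : List Bool → ℕ → ℕ → ℕ
  heightAt p           h zero    = h
  heightAt []          h (suc x) = h
  heightAt (true ∷ p)  h (suc x) = heightAt p (suc h) x
  heightAt (false ∷ p) h (suc x) = heightAt p (pred h) x

  IsBallot : ℕ → List Bool → Set
  IsBallot h       []          = ⊤
  IsBallot h       (true ∷ p)  = IsBallot (suc h) p
  IsBallot zero    (false ∷ p) = ⊥
  IsBallot (suc h) (false ∷ p) = IsBallot h p

  downSteps : List Bool → ℕ → ℕ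
  downSteps p           zero    = 0
  downSteps []          (suc x) = 0
  downSteps (true ∷ p)  (suc x) = downSteps p x
  downSteps (false ∷ p) (suc x) = suc (downSteps p x)

  heightAt-suc-≤ : ∀ p h x → heightAt p h (suc x) ≤ suc (heightAt p h x)
  heightAt-suc-≤ []          h       zero    = n≤1+n h
  heightAt-suc-≤ []          h       (suc x) = n≤1+n h
  heightAt-suc-≤ (true ∷ p)  h       zero    = ≤-refl
  heightAt-suc-≤ (true ∷ p)  h       (suc x) = heightAt-suc-≤ p (suc h) x
  heightAt-suc-≤ (false ∷ p) zero    zero    = z≤n
  heightAt-suc-≤ (false ∷ p) (suc h) zero    = m≤n⇒m≤1+n (n≤1+n h)
  heightAt-suc-≤ (false ∷ p) h       (suc x) = heightAt-suc-≤ p (pred h) x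

  heightAt-≤-suc : ∀ p h x → heightAt p h x ≤ suc (heightAt p h (suc x))
  heightAt-≤-suc []          h       zero    = n≤1+n h
  heightAt-≤-suc []          h       (suc x) = n≤1+n h
  heightAt-≤-suc (true ∷ p)  h       zero    = m≤n⇒m≤1+n (n≤1+n h)
  heightAt-≤-suc (true ∷ p)  h       (suc x) = heightAt-≤-suc p (suc h) x
  heightAt-≤-suc (false ∷ p) zero    zero    = z≤n
  heightAt-≤-suc (false ∷ p) (suc h) zero    = ≤-refl
  heightAt-≤-suc (false ∷ p) h       (suc x) = heightAt-≤-suc p (pred h) x

  heightAt-≤ : ∀ p h x → heightAt p h x ≤ h + x
  heightAt-≤ p           h       zero    = m≤m+n h 0
  heightAt-≤ []          h       (suc x) = m≤m+n h (suc x)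
  heightAt-≤ (true ∷ p)  h       (suc x) = ≤-trans (heightAt-≤ p (suc h) x) (≤-reflexive (sym (+-suc h x)))
  heightAt-≤ (false ∷ p) zero    (suc x) = m≤n⇒m≤1+n (heightAt-≤ p 0 x)
  heightAt-≤ (false ∷ p) (suc h) (suc x) = ≤-trans (heightAt-≤ p h x) (m≤n⇒m≤1+n (≤-trans (n≤1+n (h + x)) (≤-reflexive (sym (+-suc h x)))))

  heightAt+downSteps : ∀ p h x → IsBallot h p → x ≤ length p → heightAt p h x + downSteps p x + downSteps p x ≡ h + x
  heightAt+downSteps p           h       zero    _ _         = +-identityʳ (h + 0)
  heightAt+downSteps (true ∷ p)  h       (suc x) v (s≤s x≤) = trans (heightAt+downSteps p (suc h) x v x≤) (sym (+-suc h x))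
  heightAt+downSteps (false ∷ p) (suc h) (suc x) v (s≤s x≤) = begin
    heightAt p h x + suc d + suc d    ≡⟨ cong (_+ suc d) (+-suc (heightAt p h x) d) ⟩
    suc (heightAt p h x + d) + suc d  ≡⟨ cong suc (+-suc (heightAt p h x + d) d) ⟩
    suc (suc (heightAt p h x + d + d)) ≡⟨ cong (λ z → suc (suc z)) (heightAt+downSteps p h x v x≤) ⟩
    suc (suc (h + x))                 ≡⟨ cong suc (+-suc h x) ⟨
    suc h + suc x                     ∎
    where
      open ≡-Reasoning
      d = downSteps p x

  ∈-ballotPaths⁻ : ∀ L h {p} → p ∈ ballotPaths L h → IsBallot h p × length p ≡ L
  ∈-ballotPaths⁻ zero    h       (here refl) = tt , refl
  ∈-ballotPaths⁻ (suc L) zero    p∈ with ∈-map⁻ (true ∷_) p∈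
  ... | q , q∈ , refl = let v , l = ∈-ballotPaths⁻ L 1 q∈ in v , cong suc l
  ∈-ballotPaths⁻ (suc L) (suc h) p∈ with ∈-++⁻ (map (true ∷_) (ballotPaths L (suc (suc h)))) p∈
  ... | inj₁ p∈ups with ∈-map⁻ (true ∷_) p∈ups
  ...   | q , q∈ , refl = let v , l = ∈-ballotPaths⁻ L (suc (suc h)) q∈ in v , cong suc l
  ∈-ballotPaths⁻ (suc L) (suc h) p∈ | inj₂ p∈downs with ∈-map⁻ (false ∷_) p∈downs
  ...   | q , q∈ , refl = let v , l = ∈-ballotPaths⁻ L h q∈ in v , cong suc l

  ∈-ballotPaths⁺ : ∀ {h} p → IsBallot h p → p ∈ ballotPaths (length p) h
  ∈-ballotPaths⁺          []          v = here refl
  ∈-ballotPaths⁺ {zero}   (true ∷ p)  v = ∈-map⁺ (true ∷_) (∈-ballotPaths⁺ p v)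
  ∈-ballotPaths⁺ {suc h}  (true ∷ p)  v = ∈-++⁺ˡ (∈-map⁺ (true ∷_) (∈-ballotPaths⁺ p v))
  ∈-ballotPaths⁺ {suc h}  (false ∷ p) v = ∈-++⁺ʳ _ (∈-map⁺ (false ∷_) (∈-ballotPaths⁺ p v))

  ballotPaths-unique : ∀ L h → Unique (ballotPaths L h)
  ballotPaths-unique zero    h       = All.[] ∷ []
  ballotPaths-unique (suc L) zero    = Unique.map⁺ ∷-injectiveʳ (ballotPaths-unique L 1)
  ballotPaths-unique (suc L) (suc h) =
    Unique.++⁺ (Unique.map⁺ ∷-injectiveʳ (ballotPaths-unique L (suc (suc h))))
               (Unique.map⁺ ∷-injectiveʳ (ballotPaths-unique L h))
               (λ (p∈ups , p∈downs) → let _ , _ , up = ∈-map⁻ (true ∷_) p∈ups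
                                          _ , _ , down = ∈-map⁻ (false ∷_) p∈downs
                                      in true≢false (trans (sym up) down))
    where
      true≢false : ∀ {p q : List Bool} → true ∷ p ≡ false ∷ q → ⊥
      true≢false ()

  heightAt-injective : ∀ {h} p q → length p ≡ length q →
    (∀ x → x ≤ length p → heightAt p h x ≡ heightAt q h x) → p ≡ q
  heightAt-injective []          []          _ _ = refl
  heightAt-injective (true ∷ p)  (true ∷ q)  l e =
    cong (true ∷_) (heightAt-injective p q (suc-injective l) (λ x x≤ → e (suc x) (s≤s x≤)))
  heightAt-injective (false ∷ p) (false ∷ q) l e =
    cong (false ∷_) (heightAt-injective p q (suc-injective l) (λ x x≤ → e (suc x) (s≤s x≤)))
  heightAt-injective {h} (true ∷ p)  (false ∷ q) _ e = ⊥-elim (<⇒≢ (s≤s pred[n]≤n) (sym (e 1 (s≤s z≤n))))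
  heightAt-injective {h} (false ∷ p) (true ∷ q)  _ e = ⊥-elim (<⇒≢ (s≤s pred[n]≤n) (e 1 (s≤s z≤n)))

  RisesTo : ℕ → Bool → List Bool → ℕ → Set
  RisesTo h up p zero    = up ≡ true
  RisesTo h up p (suc X) = suc (heightAt p h X) ≡ heightAt p h (suc X)

  record IsHighPeak (h : ℕ) (up : Bool) (p : List Bool) (X : ℕ) : Set where
    constructor highPeak
    field
      within : X ≤ length p
      high   : 2 ≤ heightAt p h X
      rises  : RisesTo h up p X
      falls  : X ≡ length p ⊎ suc (heightAt p h (suc X)) ≡ heightAt p h X

  ∈-initialPeak⁻ : ∀ {up h X} → X ∈ initialPeak up h → X ≡ 0 × up ≡ true × 2 ≤ h
  ∈-initialPeak⁻ {true} {suc (suc h)} (here refl) = refl , refl , s≤s (s≤s z≤n)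

  ∈-initialPeak⁺ : ∀ {up h} → up ≡ true → 2 ≤ h → 0 ∈ initialPeak up h
  ∈-initialPeak⁺ {true} {suc (suc h)} refl (s≤s (s≤s z≤n)) = here refl

  ∈-peaks⁻ : ∀ h up p X → X ∈ peaks h up p → IsHighPeak h up p X
  ∈-peaks⁻ h up [] X X∈ with ∈-initialPeak⁻ {up} {h} X∈
  ... | refl , up≡true , 2≤h = highPeak z≤n 2≤h up≡true (inj₁ refl)
  ∈-peaks⁻ h up (true ∷ p) X X∈ with ∈-map⁻ suc X∈
  ... | Y , Y∈ , refl with ∈-peaks⁻ (suc h) true p Y Y∈
  ... | highPeak within high rises falls = highPeak (s≤s within) high (shift Y rises) (Sum.map₁ (cong suc) falls)
    where
      shift : ∀ Y → RisesTo (suc h) true p Y → RisesTo h up (true ∷ p) (suc Y)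
      shift zero    _ = refl
      shift (suc Y) r = r
  ∈-peaks⁻ (suc h) up (false ∷ p) X X∈ with ∈-++⁻ (initialPeak up (suc h)) X∈
  ... | inj₁ X∈₀ with ∈-initialPeak⁻ {up} {suc h} X∈₀
  ...   | refl , up≡true , 2≤h = highPeak z≤n 2≤h up≡true (inj₂ refl)
  ∈-peaks⁻ (suc h) up (false ∷ p) X X∈ | inj₂ X∈₁ with ∈-map⁻ suc X∈₁
  ... | Y , Y∈ , refl with ∈-peaks⁻ h false p Y Y∈
  ... | highPeak within high rises falls = highPeak (s≤s within) high (shift Y rises) (Sum.map₁ (cong suc) falls)
    where
      shift : ∀ Y → RisesTo h false p Y → RisesTo (suc h) up (false ∷ p) (suc Y)
      shift (suc Y) r = r

  ∈-peaks⁺ : ∀ h up p X → IsBallot h p → IsHighPeak h up p X → X ∈ peaks h up p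
  ∈-peaks⁺ h up [] zero _ (highPeak _ high rises _) = ∈-initialPeak⁺ rises high
  ∈-peaks⁺ h up (true ∷ p) zero _ (highPeak _ _ _ (inj₂ falls)) = ⊥-elim (<⇒≢ (m<n⇒m<1+n (n<1+n h)) (sym falls))
  ∈-peaks⁺ h up (true ∷ p) (suc Y) v (highPeak (s≤s within) high rises falls) =
    ∈-map⁺ suc (∈-peaks⁺ (suc h) true p Y v (highPeak within high (unshift Y rises) (Sum.map₁ suc-injective falls)))
    where
      unshift : ∀ Y → RisesTo h up (true ∷ p) (suc Y) → RisesTo (suc h) true p Y
      unshift zero    _ = refl
      unshift (suc Y) r = r
  ∈-peaks⁺ (suc h) up (false ∷ p) zero _ (highPeak _ high rises _) = ∈-++⁺ˡ (∈-initialPeak⁺ rises high)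
  ∈-peaks⁺ (suc h) up (false ∷ p) (suc Y) v (highPeak (s≤s within) high rises falls) =
    ∈-++⁺ʳ (initialPeak up (suc h))
      (∈-map⁺ suc (∈-peaks⁺ h false p Y v (highPeak within high (unshift Y rises) (Sum.map₁ suc-injective falls))))
    where
      unshift : ∀ Y → RisesTo (suc h) up (false ∷ p) (suc Y) → RisesTo h false p Y
      unshift zero    r = ⊥-elim (<⇒≢ (m<n⇒m<1+n (n<1+n h)) (sym r))
      unshift (suc Y) r = r

  initialPeak-unique : ∀ up h → Unique (initialPeak up h)
  initialPeak-unique false h             = []
  initialPeak-unique true  zero          = []
  initialPeak-unique true  (suc zero)    = []
  initialPeak-unique true  (suc (suc h)) = All.[] ∷ []

  peaks-unique : ∀ h up p → Unique (peaks h up p)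
  peaks-unique h       up []          = initialPeak-unique up h
  peaks-unique h       up (true ∷ p)  = Unique.map⁺ suc-injective (peaks-unique (suc h) true p)
  peaks-unique zero    up (false ∷ p) = []
  peaks-unique (suc h) up (false ∷ p) =
    Unique.++⁺ (initialPeak-unique up (suc h)) (Unique.map⁺ suc-injective (peaks-unique h false p))
      (λ (X∈₀ , X∈₁) → let X≡0 , _ = ∈-initialPeak⁻ {up} {suc h} X∈₀
                           _ , _ , X≡suc = ∈-map⁻ suc X∈₁
                       in 0≢1+n (trans (sym X≡0) X≡suc))

module RootVectors where

  open import Defs
  open Lists

  open import Data.Bool using (true; false; if_then_else_; T)
  open import Data.Empty using (⊥-elim)
  open import Data.Fin as Fin using (Fin; toℕ; fromℕ<)
  open import Data.Fin.Properties using (toℕ-injective; toℕ<n; toℕ-fromℕ<)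
  open import Data.Integer using (ℤ; 0ℤ; 1ℤ) renaming (_+_ to _+ℤ_; _-_ to _-ℤ_)
  import Data.Integer.Properties as ℤ
  open import Data.List using (List; []; _∷_; _++_; map; concatMap; allFin)
  open import Data.List.Membership.Propositional using (_∈_)
  open import Data.List.Membership.Propositional.Properties
    using (∈-++⁺ˡ; ∈-++⁺ʳ; ∈-++⁻)
  open import Data.List.Properties using (map-++; map-concatMap; concatMap-cong)
  open import Data.List.Relation.Unary.Any using (here; there)
  import Data.List.Relation.Unary.All as All
  open import Data.List.Relation.Unary.Unique.Propositional using (Unique; []; _∷_)
  import Data.List.Relation.Unary.Unique.Propositional.Properties as Unique
  open import Data.Nat
  open import Data.Nat.Properties
  open import Data.Product using (_,_; _×_; proj₁; proj₂; uncurry)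
  open import Data.Sum using (_⊎_; inj₁; inj₂)
  open import Data.Vec as Vec using (Vec; tabulate; zipWith)
  import Data.Vec.Properties as Vec
  open import Relation.Binary.Definitions using (tri<; tri≈; tri>)
  open import Relation.Binary.PropositionalEquality
    using (_≡_; _≢_; refl; sym; trans; cong; cong₂; subst; module ≡-Reasoning)
  open import Relation.Nullary using (Dec; does; yes; no; ¬_)
  open import Relation.Nullary.Decidable using (dec-true; dec-false)

  private variable
    A B C : Set

  a+b≡c+d∧a<c⇒d<b : ∀ {a b c d} → a + b ≡ c + d → a < c → d < b
  a+b≡c+d∧a<c⇒d<b {a} {b} {c} {d} e a<c with <-cmp d b
  ... | tri< d<b _ _ = d<b
  ... | tri≈ _ refl _ = ⊥-elim (<-irrefl e (+-monoˡ-< d a<c))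
  ... | tri> _ _ b<d = ⊥-elim (<-irrefl e (+-mono-< a<c b<d))

  a+b≡c+d∧a≤c⇒d≤b : ∀ {a b c d} → a + b ≡ c + d → a ≤ c → d ≤ b
  a+b≡c+d∧a≤c⇒d≤b {a} {b} {c} {d} e a≤c with ≤-total d b
  ... | inj₁ d≤b = d≤b
  ... | inj₂ b≤d = ≤-reflexive (+-cancelˡ-≡ c d b
        (≤-antisym (≤-trans (≤-reflexive (sym e)) (+-monoˡ-≤ b a≤c)) (+-monoʳ-≤ c b≤d)))

  module _ {n : ℕ} where

    j<n⇒n<2n∸j : ∀ {j} → j < n → n < n + n ∸ j
    j<n⇒n<2n∸j j<n = a+b≡c+d∧a<c⇒d<b (m+[n∸m]≡n (≤-trans (<⇒≤ j<n) (m≤m+n n n))) j<n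

    j<n⇒j≤2n : ∀ {j} → j < n → j ≤ n + n
    j<n⇒j≤2n j<n = ≤-trans (<⇒≤ j<n) (m≤m+n n n)

  indicator : {A : Set} → Dec A → ℤ
  indicator a? = if does a? then 1ℤ else 0ℤ

  indicator-yes : (a? : Dec A) → A → indicator a? ≡ 1ℤ
  indicator-yes a? a rewrite dec-true a? a = refl

  indicator-no : (a? : Dec A) → ¬ A → indicator a? ≡ 0ℤ
  indicator-no a? ¬a rewrite dec-false a? ¬a = refl

  indicator-cong : (a? : Dec A) (b? : Dec B) → (A → B) → (B → A) → indicator a? ≡ indicator b?
  indicator-cong (yes a) b? f g = sym (indicator-yes b? (f a))
  indicator-cong (no ¬a) b? f g = sym (indicator-no b? (λ b → ¬a (g b)))

  δ : ℕ → ℕ → ℤ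
  δ k t = indicator (k ≟ t)

  δ-shift : ∀ {k b N} → b ≤ N → δ (k + b) N ≡ δ k (N ∸ b)
  δ-shift {k} {b} {N} b≤N = indicator-cong (k + b ≟ N) (k ≟ N ∸ b)
    (λ e → +-cancelʳ-≡ b k (N ∸ b) (trans e (sym (m∸n+n≡m b≤N))))
    (λ e → trans (cong (_+ b) e) (m∸n+n≡m b≤N))

  -- Coordinate k of ε_a − ε_b + ε_(2n−b), reading ε_k = 0 for k ≥ n.  The pairs (a, b) with
  -- a < b and a + b ≤ 2n give every positive root exactly once: b < n gives ε_a − ε_b, b = n gives
  -- ε_a, n < b < 2n − a gives ε_a + ε_(2n−b), and b = 2n − a gives 2ε_a.
  rootCoordinate : ℕ → ℕ → ℕ → ℕ → ℤ
  rootCoordinate n a b k = (δ k a -ℤ δ k b) +ℤ δ (k + b) (n + n)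

  rootVector : (n : ℕ) → ℕ → ℕ → Vec ℤ n
  rootVector n a b = tabulate (λ k → rootCoordinate n a b (toℕ k))

  zipWith-tabulate : ∀ {n} (f : A → B → C) (g : Fin n → A) (h : Fin n → B) →
    zipWith f (tabulate g) (tabulate h) ≡ tabulate (λ k → f (g k) (h k))
  zipWith-tabulate {n = zero}  f g h = refl
  zipWith-tabulate {n = suc n} f g h = cong (f (g Fin.zero) (h Fin.zero) Vec.∷_) (zipWith-tabulate f (λ k → g (Fin.suc k)) (λ k → h (Fin.suc k)))

  module _ {n : ℕ} where

    ε-tabulate : (i : Fin n) → ε i ≡ tabulate (λ k → δ (toℕ k) (toℕ i))
    ε-tabulate i = Vec.tabulate-cong (λ k → indicator-cong (k Fin.≟ i) (toℕ k ≟ toℕ i) (cong toℕ) toℕ-injective)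

    k+b≢2n : ∀ (k : Fin n) {b} → b ≤ n → toℕ k + b ≢ n + n
    k+b≢2n k b≤n = <⇒≢ (+-mono-<-≤ (toℕ<n k) b≤n)

    ε-⊖-ε : (i j : Fin n) → ε i ⊖ ε j ≡ rootVector n (toℕ i) (toℕ j)
    ε-⊖-ε i j = begin
      ε i ⊖ ε j
        ≡⟨ cong₂ (zipWith _-ℤ_) (ε-tabulate i) (ε-tabulate j) ⟩
      zipWith _-ℤ_ (tabulate _) (tabulate _)
        ≡⟨ zipWith-tabulate _-ℤ_ _ _ ⟩
      tabulate (λ k → δ (toℕ k) (toℕ i) -ℤ δ (toℕ k) (toℕ j))
        ≡⟨ Vec.tabulate-cong (λ k → sym (trans (cong ((δ (toℕ k) (toℕ i) -ℤ δ (toℕ k) (toℕ j)) +ℤ_)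
                                                     (indicator-no (_ ≟ _) (k+b≢2n k (<⇒≤ (toℕ<n j)))))
                                               (ℤ.+-identityʳ _))) ⟩
      rootVector n (toℕ i) (toℕ j) ∎
      where open ≡-Reasoning

    ε-⊕-ε : (i j : Fin n) → ε i ⊕ ε j ≡ rootVector n (toℕ i) (n + n ∸ toℕ j)
    ε-⊕-ε i j = begin
      ε i ⊕ ε j
        ≡⟨ cong₂ (zipWith _+ℤ_) (ε-tabulate i) (ε-tabulate j) ⟩
      zipWith _+ℤ_ (tabulate _) (tabulate _)
        ≡⟨ zipWith-tabulate _+ℤ_ _ _ ⟩
      tabulate (λ k → δ (toℕ k) (toℕ i) +ℤ δ (toℕ k) (toℕ j))
        ≡⟨ Vec.tabulate-cong pointwise ⟩
      rootVector n (toℕ i) (n + n ∸ toℕ j) ∎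
      where
        open ≡-Reasoning
        pointwise : ∀ k → δ (toℕ k) (toℕ i) +ℤ δ (toℕ k) (toℕ j) ≡ rootCoordinate n (toℕ i) (n + n ∸ toℕ j) (toℕ k)
        pointwise k = sym (trans (cong₂ (λ u v → (δ (toℕ k) (toℕ i) -ℤ u) +ℤ v)
          (indicator-no (toℕ k ≟ n + n ∸ toℕ j) (<⇒≢ (<-trans (toℕ<n k) (j<n⇒n<2n∸j (toℕ<n j)))))
          (trans (δ-shift {toℕ k} (m∸n≤m (n + n) (toℕ j))) (cong (δ (toℕ k)) (m∸[m∸n]≡n (j<n⇒j≤2n (toℕ<n j))))))
          (cong (_+ℤ δ (toℕ k) (toℕ j)) (ℤ.+-identityʳ (δ (toℕ k) (toℕ i)))))

    ε≡rootVector : (i : Fin n) → ε i ≡ rootVector n (toℕ i) n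
    ε≡rootVector i = trans (ε-tabulate i) (Vec.tabulate-cong λ k →
      sym (trans (cong₂ (λ u v → (δ (toℕ k) (toℕ i) -ℤ u) +ℤ v)
                        (indicator-no (toℕ k ≟ n) (<⇒≢ (toℕ<n k)))
                        (indicator-no (toℕ k + n ≟ n + n) (k+b≢2n k ≤-refl)))
                 (trans (ℤ.+-identityʳ _) (ℤ.+-identityʳ _))))

  pairs-εᵢ±εⱼ : (n : ℕ) → Fin n → Fin n → List (ℕ × ℕ)
  pairs-εᵢ±εⱼ n i j = if does (i Fin.<? j) then (toℕ i , toℕ j) ∷ (toℕ i , n + n ∸ toℕ j) ∷ [] else []

  pairs-εᵢ-2εᵢ : (n : ℕ) → Fin n → List (ℕ × ℕ)
  pairs-εᵢ-2εᵢ n i = (toℕ i , n) ∷ (toℕ i , n + n ∸ toℕ i) ∷ []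

  pairs-εᵢ±ε : (n : ℕ) → Fin n → List (ℕ × ℕ)
  pairs-εᵢ±ε n i = concatMap (pairs-εᵢ±εⱼ n i) (allFin n)

  rootPairs₁ rootPairs₂ rootPairs : ℕ → List (ℕ × ℕ)
  rootPairs₁ n = concatMap (pairs-εᵢ±ε n) (allFin n)
  rootPairs₂ n = concatMap (pairs-εᵢ-2εᵢ n) (allFin n)
  rootPairs n = rootPairs₁ n ++ rootPairs₂ n

  posRoots≡map-rootVector : ∀ n → posRoots n ≡ map (uncurry (rootVector n)) (rootPairs n)
  posRoots≡map-rootVector n = sym (begin
    map v (rootPairs₁ n ++ rootPairs₂ n)
      ≡⟨ map-++ v (rootPairs₁ n) (rootPairs₂ n) ⟩
    map v (rootPairs₁ n) ++ map v (rootPairs₂ n)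
      ≡⟨ cong₂ _++_
           (trans (map-concatMap v (pairs-εᵢ±ε n) (allFin n)) (concatMap-cong (λ i →
             trans (map-concatMap v (pairs-εᵢ±εⱼ n i) (allFin n)) (concatMap-cong (pairs±-roots i) (allFin n)))
             (allFin n)))
           (trans (map-concatMap v (pairs-εᵢ-2εᵢ n) (allFin n)) (concatMap-cong pairs-2-roots (allFin n))) ⟩
    posRoots n ∎)
    where
      open ≡-Reasoning
      v = uncurry (rootVector n)
      pairs±-roots : (i j : Fin n) → map v (pairs-εᵢ±εⱼ n i j)
                     ≡ (if does (i Fin.<? j) then (ε i ⊖ ε j) ∷ (ε i ⊕ ε j) ∷ [] else [])
      pairs±-roots i j with toℕ i <ᵇ toℕ j
      ... | true  = cong₂ _∷_ (sym (ε-⊖-ε i j)) (cong (_∷ []) (sym (ε-⊕-ε i j)))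
      ... | false = refl
      pairs-2-roots : (i : Fin n) → map v (pairs-εᵢ-2εᵢ n i) ≡ ε i ∷ (ε i ⊕ ε i) ∷ []
      pairs-2-roots i = cong₂ _∷_ (sym (ε≡rootVector i)) (cong (_∷ []) (sym (ε-⊕-ε i i)))

  ValidPair : ℕ → ℕ × ℕ → Set
  ValidPair n (a , b) = a < b × a + b ≤ n + n

  module _ {n : ℕ} where

    ∈-pairs-εᵢ±εⱼ⁻ : ∀ (i j : Fin n) {c} → c ∈ pairs-εᵢ±εⱼ n i j →
      toℕ i < toℕ j × (c ≡ (toℕ i , toℕ j) ⊎ c ≡ (toℕ i , n + n ∸ toℕ j))
    ∈-pairs-εᵢ±εⱼ⁻ i j c∈ with toℕ i <ᵇ toℕ j in i<ᵇj
    ∈-pairs-εᵢ±εⱼ⁻ i j (here refl)         | true = <ᵇ⇒< _ _ (subst T (sym i<ᵇj) _) , inj₁ refl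
    ∈-pairs-εᵢ±εⱼ⁻ i j (there (here refl)) | true = <ᵇ⇒< _ _ (subst T (sym i<ᵇj) _) , inj₂ refl

    ∈-pairs-εᵢ±εⱼ⁺ : ∀ (i j : Fin n) → toℕ i < toℕ j →
      (toℕ i , toℕ j) ∈ pairs-εᵢ±εⱼ n i j × (toℕ i , n + n ∸ toℕ j) ∈ pairs-εᵢ±εⱼ n i j
    ∈-pairs-εᵢ±εⱼ⁺ i j i<j with toℕ i <ᵇ toℕ j in i<ᵇj
    ... | true  = here refl , there (here refl)
    ... | false = ⊥-elim (subst T i<ᵇj (<⇒<ᵇ i<j))

    a<b∧a+b≤2n⇒a<n : ∀ {a b} → a < b → a + b ≤ n + n → a < n
    a<b∧a+b≤2n⇒a<n {a} {b} a<b a+b≤ with <-cmp a n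
    ... | tri< a<n _ _ = a<n
    ... | tri≈ _ refl _ = ⊥-elim (<-irrefl refl (<-≤-trans (+-monoʳ-< a a<b) a+b≤))
    ... | tri> _ _ n<a = ⊥-elim (<-irrefl refl (<-≤-trans (+-mono-< n<a (<-trans n<a a<b)) a+b≤))

    ∈-rootPairs⁻ : ∀ {c} → c ∈ rootPairs n → ValidPair n c
    ∈-rootPairs⁻ c∈ with ∈-++⁻ (rootPairs₁ n) c∈
    ... | inj₁ c∈₁ =
      let i , c∈ᵢ = ∈-concatMap-allFin⁻ (pairs-εᵢ±ε n) c∈₁
          j , c∈ᵢⱼ = ∈-concatMap-allFin⁻ (pairs-εᵢ±εⱼ n i) c∈ᵢ
      in pairs± i j (∈-pairs-εᵢ±εⱼ⁻ i j c∈ᵢⱼ)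
      where
        pairs± : ∀ i j {c} → toℕ i < toℕ j × (c ≡ (toℕ i , toℕ j) ⊎ c ≡ (toℕ i , n + n ∸ toℕ j)) → ValidPair n c
        pairs± i j (i<j , inj₁ refl) = i<j , +-mono-≤ (<⇒≤ (toℕ<n i)) (<⇒≤ (toℕ<n j))
        pairs± i j (i<j , inj₂ refl) = <-trans (toℕ<n i) (j<n⇒n<2n∸j (toℕ<n j)) ,
          ≤-trans (+-monoˡ-≤ (n + n ∸ toℕ j) (<⇒≤ i<j)) (≤-reflexive (m+[n∸m]≡n (j<n⇒j≤2n (toℕ<n j))))
    ... | inj₂ c∈₂ = let i , c∈ᵢ = ∈-concatMap-allFin⁻ (pairs-εᵢ-2εᵢ n) c∈₂ in pairs-2 i c∈ᵢ
      where
        pairs-2 : ∀ i {c} → c ∈ pairs-εᵢ-2εᵢ n i → ValidPair n c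
        pairs-2 i (here refl)         = toℕ<n i , +-monoˡ-≤ n (<⇒≤ (toℕ<n i))
        pairs-2 i (there (here refl)) = <-trans (toℕ<n i) (j<n⇒n<2n∸j (toℕ<n i)) , ≤-reflexive (m+[n∸m]≡n (j<n⇒j≤2n (toℕ<n i)))

    ∈-rootPairs₁⁺ : ∀ (i j : Fin n) {c} → c ∈ pairs-εᵢ±εⱼ n i j → c ∈ rootPairs n
    ∈-rootPairs₁⁺ i j c∈ = ∈-++⁺ˡ (∈-concatMap-allFin⁺ (pairs-εᵢ±ε n) i (∈-concatMap-allFin⁺ (pairs-εᵢ±εⱼ n i) j c∈))

    ∈-rootPairs₂⁺ : ∀ (i : Fin n) {c} → c ∈ pairs-εᵢ-2εᵢ n i → c ∈ rootPairs n
    ∈-rootPairs₂⁺ i c∈ = ∈-++⁺ʳ (rootPairs₁ n) (∈-concatMap-allFin⁺ (pairs-εᵢ-2εᵢ n) i c∈)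

    ∈-rootPairs⁺ᵢ : ∀ (i : Fin n) b → toℕ i < b → toℕ i + b ≤ n + n → (toℕ i , b) ∈ rootPairs n
    ∈-rootPairs⁺ᵢ i b i<b i+b≤ with <-cmp b n
    ... | tri< b<n _ _ =
      subst (λ b → (toℕ i , b) ∈ rootPairs n) (toℕ-fromℕ< b<n)
        (∈-rootPairs₁⁺ i j (proj₁ (∈-pairs-εᵢ±εⱼ⁺ i j (subst (toℕ i <_) (sym (toℕ-fromℕ< b<n)) i<b))))
      where j = fromℕ< b<n
    ... | tri≈ _ refl _ = ∈-rootPairs₂⁺ i (here refl)
    ... | tri> _ _ n<b with toℕ i + b ≟ n + n
    ...   | yes i+b≡2n = ∈-rootPairs₂⁺ i (there (here (cong (toℕ i ,_) b≡2n∸i)))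
      where b≡2n∸i = sym (trans (cong (_∸ toℕ i) (sym i+b≡2n)) (m+n∸m≡n (toℕ i) b))
    ...   | no  i+b≢2n =
      subst (λ b → (toℕ i , b) ∈ rootPairs n) 2n∸[2n∸b]≡b (∈-rootPairs₁⁺ i j (proj₂ (∈-pairs-εᵢ±εⱼ⁺ i j i<j)))
      where
        b≤2n = m+n≤o⇒n≤o (toℕ i) i+b≤
        2n∸b<n : n + n ∸ b < n
        2n∸b<n = a+b≡c+d∧a<c⇒d<b (sym (trans (+-comm b _) (m∸n+n≡m b≤2n))) n<b
        j = fromℕ< 2n∸b<n
        i<j : toℕ i < toℕ j
        i<j = subst (toℕ i <_) (sym (toℕ-fromℕ< 2n∸b<n))
                (+-cancelʳ-< b (toℕ i) _ (<-≤-trans (≤∧≢⇒< i+b≤ i+b≢2n) (≤-reflexive (sym (m∸n+n≡m b≤2n)))))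
        2n∸[2n∸b]≡b : n + n ∸ toℕ j ≡ b
        2n∸[2n∸b]≡b = trans (cong (n + n ∸_) (toℕ-fromℕ< 2n∸b<n)) (m∸[m∸n]≡n b≤2n)

    ∈-rootPairs⁺ : ∀ a b → a < b → a + b ≤ n + n → (a , b) ∈ rootPairs n
    ∈-rootPairs⁺ a b a<b a+b≤ = subst (λ a → (a , b) ∈ rootPairs n) (toℕ-fromℕ< a<n)
      (∈-rootPairs⁺ᵢ (fromℕ< a<n) b (subst (_< b) (sym (toℕ-fromℕ< a<n)) a<b)
                                    (subst (λ a → a + b ≤ n + n) (sym (toℕ-fromℕ< a<n)) a+b≤))
      where a<n = a<b∧a+b≤2n⇒a<n a<b a+b≤

    private
      2n∸j≢j : (j : Fin n) → toℕ j < n + n ∸ toℕ j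
      2n∸j≢j j = <-trans (toℕ<n j) (j<n⇒n<2n∸j (toℕ<n j))

      2n∸-injective : (j j′ : Fin n) → n + n ∸ toℕ j ≡ n + n ∸ toℕ j′ → j ≡ j′
      2n∸-injective j j′ e = toℕ-injective (trans (sym (m∸[m∸n]≡n (j<n⇒j≤2n (toℕ<n j))))
                                   (trans (cong (n + n ∸_) e) (m∸[m∸n]≡n (j<n⇒j≤2n (toℕ<n j′)))))

    pairs-εᵢ±εⱼ-unique : ∀ (i j : Fin n) → Unique (pairs-εᵢ±εⱼ n i j)
    pairs-εᵢ±εⱼ-unique i j with toℕ i <ᵇ toℕ j
    ... | true  = ((λ e → <-irrefl (cong proj₂ e) (2n∸j≢j j)) All.∷ All.[]) ∷ All.[] ∷ []
    ... | false = []

    pairs-εᵢ-2εᵢ-unique : ∀ (i : Fin n) → Unique (pairs-εᵢ-2εᵢ n i)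
    pairs-εᵢ-2εᵢ-unique i = ((λ e → <-irrefl (cong proj₂ e) (j<n⇒n<2n∸j (toℕ<n i))) All.∷ All.[]) ∷ All.[] ∷ []

    pairs-εᵢ±εⱼ-disjoint : ∀ (i j j′ : Fin n) {c} → c ∈ pairs-εᵢ±εⱼ n i j → c ∈ pairs-εᵢ±εⱼ n i j′ → j ≡ j′
    pairs-εᵢ±εⱼ-disjoint i j j′ c∈ c∈′ with ∈-pairs-εᵢ±εⱼ⁻ i j c∈ | ∈-pairs-εᵢ±εⱼ⁻ i j′ c∈′
    ... | _ , inj₁ refl | _ , inj₁ e = toℕ-injective (cong proj₂ e)
    ... | _ , inj₁ refl | _ , inj₂ e = ⊥-elim (<-irrefl (cong proj₂ e) (<-trans (toℕ<n j) (j<n⇒n<2n∸j (toℕ<n j′))))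
    ... | _ , inj₂ refl | _ , inj₁ e = ⊥-elim (<-irrefl (sym (cong proj₂ e)) (<-trans (toℕ<n j′) (j<n⇒n<2n∸j (toℕ<n j))))
    ... | _ , inj₂ refl | _ , inj₂ e = 2n∸-injective j j′ (cong proj₂ e)

    ∈-pairs-εᵢ±ε⇒fst : ∀ (i : Fin n) {c} → c ∈ pairs-εᵢ±ε n i → proj₁ c ≡ toℕ i
    ∈-pairs-εᵢ±ε⇒fst i c∈ with ∈-concatMap-allFin⁻ (pairs-εᵢ±εⱼ n i) c∈
    ... | j , c∈ⱼ with ∈-pairs-εᵢ±εⱼ⁻ i j c∈ⱼ
    ...   | _ , inj₁ refl = refl
    ...   | _ , inj₂ refl = refl

    ∈-pairs-εᵢ-2εᵢ⇒fst : ∀ (i : Fin n) {c} → c ∈ pairs-εᵢ-2εᵢ n i → proj₁ c ≡ toℕ i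
    ∈-pairs-εᵢ-2εᵢ⇒fst i (here refl)         = refl
    ∈-pairs-εᵢ-2εᵢ⇒fst i (there (here refl)) = refl

    rootPairs₁-unique : Unique (rootPairs₁ n)
    rootPairs₁-unique = Unique-concatMap⁺ (pairs-εᵢ±ε n)
      (λ {i} _ → Unique-concatMap⁺ (pairs-εᵢ±εⱼ n i) (λ {j} _ → pairs-εᵢ±εⱼ-unique i j)
                   (λ {j} {j′} _ _ → pairs-εᵢ±εⱼ-disjoint i j j′) (Unique.allFin⁺ n))
      (λ {i} {i′} _ _ c∈ c∈′ → toℕ-injective (trans (sym (∈-pairs-εᵢ±ε⇒fst i c∈)) (∈-pairs-εᵢ±ε⇒fst i′ c∈′)))
      (Unique.allFin⁺ n)

    rootPairs₂-unique : Unique (rootPairs₂ n)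
    rootPairs₂-unique = Unique-concatMap⁺ (pairs-εᵢ-2εᵢ n) (λ {i} _ → pairs-εᵢ-2εᵢ-unique i)
      (λ {i} {i′} _ _ c∈ c∈′ → toℕ-injective (trans (sym (∈-pairs-εᵢ-2εᵢ⇒fst i c∈)) (∈-pairs-εᵢ-2εᵢ⇒fst i′ c∈′)))
      (Unique.allFin⁺ n)

    OnBoundary : ℕ × ℕ → Set
    OnBoundary (a , b) = b ≡ n ⊎ a + b ≡ n + n

    ∈-rootPairs₂⇒OnBoundary : ∀ {c} → c ∈ rootPairs₂ n → OnBoundary c
    ∈-rootPairs₂⇒OnBoundary c∈ with ∈-concatMap-allFin⁻ (pairs-εᵢ-2εᵢ n) c∈
    ... | i , here refl         = inj₁ refl
    ... | i , there (here refl) = inj₂ (m+[n∸m]≡n (j<n⇒j≤2n (toℕ<n i)))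

    ∈-rootPairs₁⇒¬OnBoundary : ∀ {c} → c ∈ rootPairs₁ n → ¬ OnBoundary c
    ∈-rootPairs₁⇒¬OnBoundary c∈ with ∈-concatMap-allFin⁻ (pairs-εᵢ±ε n) c∈
    ... | i , c∈ᵢ with ∈-concatMap-allFin⁻ (pairs-εᵢ±εⱼ n i) c∈ᵢ
    ... | j , c∈ᵢⱼ with ∈-pairs-εᵢ±εⱼ⁻ i j c∈ᵢⱼ
    ... | _   , inj₁ refl = λ { (inj₁ e) → <-irrefl e (toℕ<n j) ; (inj₂ e) → <-irrefl e (+-mono-< (toℕ<n i) (toℕ<n j)) }
    ... | i<j , inj₂ refl = λ { (inj₁ e) → <-irrefl (sym e) (j<n⇒n<2n∸j (toℕ<n j))
                             ; (inj₂ e) → <-irrefl e (<-≤-trans (+-monoˡ-< (n + n ∸ toℕ j) i<j)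
                                                                 (≤-reflexive (m+[n∸m]≡n (j<n⇒j≤2n (toℕ<n j))))) }

    rootPairs-unique : Unique (rootPairs n)
    rootPairs-unique = Unique.++⁺ rootPairs₁-unique rootPairs₂-unique
      (λ (c∈₁ , c∈₂) → ∈-rootPairs₁⇒¬OnBoundary c∈₁ (∈-rootPairs₂⇒OnBoundary c∈₂))

module RootPairs where

  open import Defs
  open Lists
  open RootVectors

  open import Data.Bool using (true; if_then_else_; T)
  open import Data.Fin as Fin using (Fin; toℕ; fromℕ<)
  open import Data.Fin.Properties using (toℕ<n; toℕ-fromℕ<)
  open import Data.Integer using (ℤ; 0ℤ) renaming (_+_ to _+ℤ_; _-_ to _-ℤ_)
  import Data.Integer.Properties as ℤ
  open import Data.Integer.Tactic.RingSolver using (solve-∀)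
  open import Data.List using (List; []; _∷_; concatMap; allFin; lookup)
  open import Data.List.Membership.Propositional using (_∈_)
  open import Data.List.Membership.Propositional.Properties using (∈-++⁺ˡ; ∈-++⁺ʳ; ∈-++⁻; ∈-lookup)
  open import Data.List.Relation.Unary.Any as Any using (here)
  open import Data.List.Relation.Unary.Any.Properties using (lookup-index)
  import Data.List.Relation.Unary.Unique.Propositional.Properties as Unique
  open import Data.Nat
  open import Data.Nat.Properties
  open import Data.Product using (Σ; _,_; _×_; uncurry)
  open import Data.Sum using (inj₁; inj₂)
  open import Data.Vec as Vec using (Vec)
  import Data.Vec.Properties as Vec
  open import Relation.Binary.PropositionalEquality
    using (_≡_; refl; sym; trans; cong; cong₂; subst; module ≡-Reasoning)

  module _ (n : ℕ) where

    private
      posRoots≡ = posRoots≡map-rootVector n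

    -- Opaque: everything later uses rootPair only through the lemmas of this block, which keeps the
    -- huge normal forms of posRoots out of type checking.
    opaque
      rootPair : Fin (N n) → ℕ × ℕ
      rootPair p = lookup (rootPairs n) (reindex (uncurry (rootVector n)) posRoots≡ p)

      root≡rootVector : ∀ p → root n p ≡ uncurry (rootVector n) (rootPair p)
      root≡rootVector = lookup-reindex (uncurry (rootVector n)) posRoots≡

      rootPair-valid : ∀ p → ValidPair n (rootPair p)
      rootPair-valid p = ∈-rootPairs⁻ {n} (∈-lookup (reindex (uncurry (rootVector n)) posRoots≡ p))

      rootPair-injective : ∀ {p q} → rootPair p ≡ rootPair q → p ≡ q
      rootPair-injective e = reindex-injective (uncurry (rootVector n)) posRoots≡ (lookup-injective (rootPairs-unique {n}) e)

      rootPair-surjective : ∀ a b → a < b → a + b ≤ n + n → Σ (Fin (N n)) λ p → rootPair p ≡ (a , b)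
      rootPair-surjective a b a<b a+b≤ =
        let c∈ = ∈-rootPairs⁺ {n} a b a<b a+b≤
            p , reindex-p≡ = reindex-surjective (uncurry (rootVector n)) posRoots≡ (Any.index c∈)
        in p , trans (cong (lookup (rootPairs n)) reindex-p≡) (sym (lookup-index c∈))

  m∸n≡1+m∸[1+n] : ∀ {m n} → suc n ≤ m → m ∸ n ≡ suc (m ∸ suc n)
  m∸n≡1+m∸[1+n] {suc m} (s≤s n≤m) = +-∸-assoc 1 n≤m

  ≡ᵇ-reflexive : ∀ {m n} → m ≡ n → (m ≡ᵇ n) ≡ true
  ≡ᵇ-reflexive {zero}  refl = refl
  ≡ᵇ-reflexive {suc m} refl = ≡ᵇ-reflexive {m} refl

  module _ {n : ℕ} where

    private
      simple-εᵢ-εⱼ : Fin n → Fin n → List (Vec ℤ n)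
      simple-εᵢ-εⱼ i j = if toℕ j ≡ᵇ suc (toℕ i) then (ε i ⊖ ε j) ∷ [] else []

      simple-εᵢ-ε : Fin n → List (Vec ℤ n)
      simple-εᵢ-ε i = concatMap (simple-εᵢ-εⱼ i) (allFin n)

      simple-εᵢ : Fin n → List (Vec ℤ n)
      simple-εᵢ i = if suc (toℕ i) ≡ᵇ n then ε i ∷ [] else []

    ∈-simpleRoots⁺ : ∀ s → suc s ≤ n → rootVector n s (suc s) ∈ simpleRoots n
    ∈-simpleRoots⁺ s 1+s≤n with m≤n⇒m<n∨m≡n 1+s≤n
    ... | inj₁ 1+s<n = ∈-++⁺ˡ (∈-concatMap-allFin⁺ simple-εᵢ-ε i (∈-concatMap-allFin⁺ (simple-εᵢ-εⱼ i) j
            (subst (λ b → rootVector n s (suc s) ∈ (if b then (ε i ⊖ ε j) ∷ [] else []))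
                   (sym (≡ᵇ-reflexive (trans toℕj (cong suc (sym toℕi)))))
                   (here (sym (trans (ε-⊖-ε i j) (cong₂ (rootVector n) toℕi toℕj)))))))
      where
        s<n = <-trans (n<1+n s) 1+s<n
        i = fromℕ< s<n
        j = fromℕ< 1+s<n
        toℕi = toℕ-fromℕ< s<n
        toℕj = toℕ-fromℕ< 1+s<n
    ... | inj₂ refl = ∈-++⁺ʳ (concatMap simple-εᵢ-ε (allFin n)) (∈-concatMap-allFin⁺ simple-εᵢ i
            (subst (λ b → rootVector n s (suc s) ∈ (if b then ε i ∷ [] else []))
                   (sym (≡ᵇ-reflexive (cong suc toℕi)))
                   (here (sym (trans (ε≡rootVector i) (cong (λ a → rootVector n a (suc s)) toℕi))))))
      where
        i = fromℕ< (n<1+n s)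
        toℕi = toℕ-fromℕ< (n<1+n s)

    ∈-simpleRoots⁻ : ∀ {v} → v ∈ simpleRoots n → Σ ℕ λ s → suc s ≤ n × v ≡ rootVector n s (suc s)
    ∈-simpleRoots⁻ {v} v∈ with ∈-++⁻ (concatMap simple-εᵢ-ε (allFin n)) v∈
    ... | inj₁ v∈₁ = let i , v∈ᵢ = ∈-concatMap-allFin⁻ simple-εᵢ-ε v∈₁
                         j , v∈ᵢⱼ = ∈-concatMap-allFin⁻ (simple-εᵢ-εⱼ i) v∈ᵢ in ε-⊖-ε-simple i j v∈ᵢⱼ
      where
        ε-⊖-ε-simple : ∀ i j → v ∈ simple-εᵢ-εⱼ i j →
                       Σ ℕ λ s → suc s ≤ n × v ≡ rootVector n s (suc s)
        ε-⊖-ε-simple i j v∈ with toℕ j ≡ᵇ suc (toℕ i) in j≡ᵇ1+i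
        ε-⊖-ε-simple i j (here v≡) | true =
          let toℕj = ≡ᵇ⇒≡ (toℕ j) (suc (toℕ i)) (subst T (sym j≡ᵇ1+i) _) in
          toℕ i , subst (_≤ n) toℕj (<⇒≤ (toℕ<n j)) , trans v≡ (trans (ε-⊖-ε i j) (cong (rootVector n (toℕ i)) toℕj))
    ... | inj₂ v∈₂ = let i , v∈ᵢ = ∈-concatMap-allFin⁻ simple-εᵢ v∈₂ in ε-simple i v∈ᵢ
      where
        ε-simple : ∀ i → v ∈ simple-εᵢ i →
                   Σ ℕ λ s → suc s ≤ n × v ≡ rootVector n s (suc s)
        ε-simple i v∈ with suc (toℕ i) ≡ᵇ n in 1+i≡ᵇn
        ε-simple i (here v≡) | true =
          let 1+i≡n = ≡ᵇ⇒≡ (suc (toℕ i)) n (subst T (sym 1+i≡ᵇn) _) in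
          toℕ i , ≤-reflexive 1+i≡n , trans v≡ (trans (ε≡rootVector i) (cong (rootVector n (toℕ i)) (sym 1+i≡n)))

  module _ {n : ℕ} where

    ⊖-rootVector⁺ : ∀ {a b a′ b′ s t} →
      (∀ (k : Fin n) → rootCoordinate n a b (toℕ k) -ℤ rootCoordinate n a′ b′ (toℕ k) ≡ rootCoordinate n s t (toℕ k)) →
      rootVector n a b ⊖ rootVector n a′ b′ ≡ rootVector n s t
    ⊖-rootVector⁺ pointwise = trans (zipWith-tabulate _-ℤ_ _ _) (Vec.tabulate-cong pointwise)

    ⊖-rootVector⁻ : ∀ {a b a′ b′ s t} → rootVector n a b ⊖ rootVector n a′ b′ ≡ rootVector n s t →
      ∀ m → m < n → rootCoordinate n a b m -ℤ rootCoordinate n a′ b′ m ≡ rootCoordinate n s t m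
    ⊖-rootVector⁻ {a} {b} {a′} {b′} {s} {t} e m m<n =
      subst (λ m → rootCoordinate n a b m -ℤ rootCoordinate n a′ b′ m ≡ rootCoordinate n s t m) (toℕ-fromℕ< m<n)
        (trans (sym (Vec.lookup∘tabulate _ k))
          (trans (cong (λ v → Vec.lookup v k) (trans (sym (zipWith-tabulate _-ℤ_ _ _)) e))
                 (Vec.lookup∘tabulate _ k)))
      where k = fromℕ< m<n

  private
    lead-step : ∀ (x y z w : ℤ) → ((x -ℤ y) +ℤ z) -ℤ ((w -ℤ y) +ℤ z) ≡ (x -ℤ w) +ℤ 0ℤ
    lead-step = solve-∀

    rank-step : ∀ (x y w : ℤ) → ((x -ℤ y) +ℤ 0ℤ) -ℤ ((x -ℤ w) +ℤ 0ℤ) ≡ (w -ℤ y) +ℤ 0ℤ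
    rank-step = solve-∀

    reflected-rank-step : ∀ (x u w : ℤ) → ((x -ℤ 0ℤ) +ℤ u) -ℤ ((x -ℤ 0ℤ) +ℤ w) ≡ (u -ℤ w) +ℤ 0ℤ
    reflected-rank-step = solve-∀

  module _ {n : ℕ} where

    rootVector-lead-step : ∀ a b → suc a ≤ n → rootVector n a b ⊖ rootVector n (suc a) b ≡ rootVector n a (suc a)
    rootVector-lead-step a b 1+a≤n = ⊖-rootVector⁺ λ k →
      trans (lead-step (δ (toℕ k) a) (δ (toℕ k) b) (δ (toℕ k + b) (n + n)) (δ (toℕ k) (suc a)))
            (cong (δ (toℕ k) a -ℤ δ (toℕ k) (suc a) +ℤ_) (sym (indicator-no (_ ≟ _) (k+b≢2n k 1+a≤n))))

    rootVector-rank-step : ∀ a b → suc b ≤ n → rootVector n a (suc b) ⊖ rootVector n a b ≡ rootVector n b (suc b)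
    rootVector-rank-step a b 1+b≤n = ⊖-rootVector⁺ λ k →
      trans (cong₂ (λ u v → ((δ (toℕ k) a -ℤ δ (toℕ k) (suc b)) +ℤ u) -ℤ ((δ (toℕ k) a -ℤ δ (toℕ k) b) +ℤ v))
                   (indicator-no (_ ≟ _) (k+b≢2n k 1+b≤n)) (indicator-no (_ ≟ _) (k+b≢2n k (<⇒≤ 1+b≤n))))
        (trans (rank-step (δ (toℕ k) a) (δ (toℕ k) (suc b)) (δ (toℕ k) b))
               (cong (δ (toℕ k) b -ℤ δ (toℕ k) (suc b) +ℤ_) (sym (indicator-no (_ ≟ _) (k+b≢2n k 1+b≤n)))))

    rootVector-reflected-rank-step : ∀ a b → n ≤ b → suc b ≤ n + n →
      rootVector n a (suc b) ⊖ rootVector n a b ≡ rootVector n (n + n ∸ suc b) (suc (n + n ∸ suc b))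
    rootVector-reflected-rank-step a b n≤b 1+b≤2n = ⊖-rootVector⁺ λ k →
      trans (cong₄ (λ u v w x → ((δ (toℕ k) a -ℤ u) +ℤ w) -ℤ ((δ (toℕ k) a -ℤ v) +ℤ x))
                   (indicator-no (_ ≟ _) (<⇒≢ (<-≤-trans (toℕ<n k) (m≤n⇒m≤1+n n≤b))))
                   (indicator-no (_ ≟ _) (<⇒≢ (<-≤-trans (toℕ<n k) n≤b)))
                   (δ-shift {toℕ k} 1+b≤2n)
                   (trans (δ-shift {toℕ k} (<⇒≤ 1+b≤2n)) (cong (δ (toℕ k)) 2n∸b≡1+s)))
        (trans (reflected-rank-step (δ (toℕ k) a) (δ (toℕ k) s) (δ (toℕ k) (suc s)))
               (cong (δ (toℕ k) s -ℤ δ (toℕ k) (suc s) +ℤ_) (sym (indicator-no (_ ≟ _) (k+b≢2n k 1+s≤n)))))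
      where
        s = n + n ∸ suc b
        2n∸b≡1+s : n + n ∸ b ≡ suc s
        2n∸b≡1+s = m∸n≡1+m∸[1+n] 1+b≤2n
        1+s≤n : suc s ≤ n
        1+s≤n = subst (_≤ n) 2n∸b≡1+s (≤-trans (∸-monoʳ-≤ (n + n) n≤b) (≤-reflexive (m+n∸n≡m n n)))
        cong₄ : ∀ {A : Set} (f : ℤ → ℤ → ℤ → ℤ → A) {a a′ b b′ c c′ d d′} →
                a ≡ a′ → b ≡ b′ → c ≡ c′ → d ≡ d′ → f a b c d ≡ f a′ b′ c′ d′
        cong₄ f refl refl refl refl = refl

module CoverElimination where

  open import Defs
  open RootVectors
  open RootPairs

  open import Data.Empty using (⊥-elim)
  open import Data.Integer using (ℤ; 0ℤ; 1ℤ; +_) renaming (_+_ to _+ℤ_; _-_ to _-ℤ_)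
  import Data.Integer.Properties as ℤ
  open import Data.Integer.Tactic.RingSolver using (solve-∀)
  open import Data.Nat
  open import Data.Nat.Properties
  open import Data.Sum using (_⊎_; inj₁; inj₂)
  open import Relation.Binary.Definitions using (tri<; tri≈; tri>)
  open import Relation.Binary.PropositionalEquality
    using (_≡_; _≢_; ≢-sym; refl; sym; trans; cong; cong₂; module ≡-Reasoning)
  open import Relation.Nullary using (¬_; Dec; yes; no)

  prefixSum : (ℕ → ℤ) → ℕ → ℤ
  prefixSum f zero    = 0ℤ
  prefixSum f (suc M) = prefixSum f M +ℤ f M

  prefixSum-cong : ∀ {f g} M → (∀ m → m < M → f m ≡ g m) → prefixSum f M ≡ prefixSum g M
  prefixSum-cong zero    f≗g = refl
  prefixSum-cong (suc M) f≗g = cong₂ _+ℤ_ (prefixSum-cong M (λ m m<M → f≗g m (m<n⇒m<1+n m<M))) (f≗g M (n<1+n M))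

  prefixSum-sub : ∀ f g M → prefixSum f M -ℤ prefixSum g M ≡ prefixSum (λ m → f m -ℤ g m) M
  prefixSum-sub f g zero    = refl
  prefixSum-sub f g (suc M) = trans (shuffle (prefixSum f M) (f M) (prefixSum g M) (g M))
                                  (cong (_+ℤ (f M -ℤ g M)) (prefixSum-sub f g M))
    where
      shuffle : ∀ a b c d → (a +ℤ b) -ℤ (c +ℤ d) ≡ (a -ℤ c) +ℤ (b -ℤ d)
      shuffle = solve-∀

  prefixSum-sub-add : ∀ f g h M → prefixSum (λ m → (f m -ℤ g m) +ℤ h m) M ≡ (prefixSum f M -ℤ prefixSum g M) +ℤ prefixSum h M
  prefixSum-sub-add f g h zero    = refl
  prefixSum-sub-add f g h (suc M) = trans (cong (_+ℤ ((f M -ℤ g M) +ℤ h M)) (prefixSum-sub-add f g h M))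
                                     (shuffle (prefixSum f M) (prefixSum g M) (prefixSum h M) (f M) (g M) (h M))
    where
      shuffle : ∀ A B C a b c → ((A -ℤ B) +ℤ C) +ℤ ((a -ℤ b) +ℤ c) ≡ ((A +ℤ a) -ℤ (B +ℤ b)) +ℤ (C +ℤ c)
      shuffle = solve-∀

  prefixSum-δ : ∀ t M → prefixSum (λ m → δ m t) M ≡ indicator (t <? M)
  prefixSum-δ t zero = refl
  prefixSum-δ t (suc M) rewrite prefixSum-δ t M with <-cmp t M
  ... | tri< t<M _ _ rewrite indicator-yes (t <? M) t<M | indicator-yes (t <? suc M) (m<n⇒m<1+n t<M)
                           | indicator-no (M ≟ t) (≢-sym (<⇒≢ t<M)) = refl
  ... | tri≈ _ refl _ rewrite indicator-no (t <? t) (<-irrefl refl) | indicator-yes (t <? suc t) (n<1+n t)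
                            | indicator-yes (t ≟ t) refl = refl
  ... | tri> _ _ M<t rewrite indicator-no (t <? M) (<⇒≯ M<t) | indicator-no (t <? suc M) (λ t<1+M → <⇒≱ M<t (≤-pred t<1+M))
                           | indicator-no (M ≟ t) (<⇒≢ M<t) = refl

  prefixSum-[<1+] : ∀ t k → prefixSum (λ M → indicator (t <? suc M)) k ≡ + (k ∸ t)
  prefixSum-[<1+] t zero = cong +_ (sym (0∸n≡0 t))
  prefixSum-[<1+] t (suc k) rewrite prefixSum-[<1+] t k with ≤-<-connex t k
  ... | inj₁ t≤k rewrite indicator-yes (t <? suc k) (s≤s t≤k) =
    trans (sym (ℤ.pos-+ (k ∸ t) 1)) (cong +_ (trans (+-comm (k ∸ t) 1) (sym (+-∸-assoc 1 t≤k))))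
  ... | inj₂ k<t rewrite indicator-no (t <? suc k) (λ t<1+k → <⇒≱ k<t (≤-pred t<1+k))
                       | m≤n⇒m∸n≡0 (<⇒≤ k<t) | m≤n⇒m∸n≡0 k<t = refl

  private
    +x-+y++z≡+w : ∀ x y z w → x + z ≡ w + y → (+ x -ℤ + y) +ℤ + z ≡ + w
    +x-+y++z≡+w x y z w x+z≡w+y = begin
      (+ x -ℤ + y) +ℤ + z   ≡⟨ shuffle (+ x) (+ y) (+ z) ⟩
      (+ x +ℤ + z) -ℤ + y   ≡⟨ cong (_-ℤ + y) (ℤ.pos-+ x z) ⟨
      + (x + z) -ℤ + y      ≡⟨ cong (λ u → + u -ℤ + y) x+z≡w+y ⟩
      + (w + y) -ℤ + y      ≡⟨ cong (_-ℤ + y) (ℤ.pos-+ w y) ⟩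
      (+ w +ℤ + y) -ℤ + y   ≡⟨ cancel (+ w) (+ y) ⟩
      + w                   ∎
      where
        open ≡-Reasoning
        shuffle : ∀ x y z → (x -ℤ y) +ℤ z ≡ (x +ℤ z) -ℤ y
        shuffle = solve-∀
        cancel : ∀ w y → (w +ℤ y) -ℤ y ≡ w
        cancel = solve-∀

    +x-+y≡1⇒x≡1+y : ∀ x y → + x -ℤ + y ≡ 1ℤ → x ≡ suc y
    +x-+y≡1⇒x≡1+y x y e = ℤ.+-injective (begin
      + x                    ≡⟨ shuffle (+ x) (+ y) ⟩
      (+ x -ℤ + y) +ℤ + y    ≡⟨ cong (_+ℤ + y) e ⟩
      1ℤ +ℤ + y              ≡⟨ ℤ.pos-+ 1 y ⟨
      + suc y                ∎)
      where
        open ≡-Reasoning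
        shuffle : ∀ x y → x ≡ (x -ℤ y) +ℤ y
        shuffle = solve-∀

  module _ (n : ℕ) where

    rootPrefix : ℕ → ℕ → ℕ → ℤ
    rootPrefix a b M = (indicator (a <? M) -ℤ indicator (b <? M)) +ℤ indicator (n + n ∸ b <? M)

    prefixSum-rootCoordinate : ∀ a b M → b ≤ n + n → prefixSum (rootCoordinate n a b) M ≡ rootPrefix a b M
    prefixSum-rootCoordinate a b M b≤2n = begin
      prefixSum (rootCoordinate n a b) M
        ≡⟨ prefixSum-cong M (λ m _ → cong (δ m a -ℤ δ m b +ℤ_) (δ-shift {m} b≤2n)) ⟩
      prefixSum (λ m → (δ m a -ℤ δ m b) +ℤ δ m (n + n ∸ b)) M
        ≡⟨ prefixSum-sub-add (λ m → δ m a) (λ m → δ m b) (λ m → δ m (n + n ∸ b)) M ⟩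
      (prefixSum (λ m → δ m a) M -ℤ prefixSum (λ m → δ m b) M) +ℤ prefixSum (λ m → δ m (n + n ∸ b)) M
        ≡⟨ cong₂ _+ℤ_ (cong₂ _-ℤ_ (prefixSum-δ a M) (prefixSum-δ b M)) (prefixSum-δ (n + n ∸ b) M) ⟩
      rootPrefix a b M ∎
      where open ≡-Reasoning

    1+s≤n⇒n≤2n∸[1+s] : ∀ {s} → suc s ≤ n → n ≤ n + n ∸ suc s
    1+s≤n⇒n≤2n∸[1+s] 1+s≤n = a+b≡c+d∧a≤c⇒d≤b (m+[n∸m]≡n (≤-trans 1+s≤n (m≤m+n n n))) 1+s≤n

    rootPrefix-simple : ∀ s M → suc s ≤ n → M ≤ n → rootPrefix s (suc s) M ≡ δ M (suc s)
    rootPrefix-simple s M 1+s≤n M≤n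
      rewrite indicator-no (n + n ∸ suc s <? M) (λ lt → <⇒≱ lt (≤-trans M≤n (1+s≤n⇒n≤2n∸[1+s] 1+s≤n)))
      with <-cmp M (suc s)
    ... | tri< M<1+s _ _ rewrite indicator-no (s <? M) (λ s<M → <⇒≱ M<1+s s<M)
                               | indicator-no (suc s <? M) (λ 1+s<M → <⇒≱ M<1+s (<⇒≤ 1+s<M))
                               | indicator-no (M ≟ suc s) (<⇒≢ M<1+s) = refl
    ... | tri≈ _ refl _ rewrite indicator-yes (s <? suc s) (n<1+n s) | indicator-no (suc s <? suc s) (<-irrefl refl)
                              | indicator-yes (suc s ≟ suc s) refl = refl
    ... | tri> _ _ 1+s<M rewrite indicator-yes (s <? M) (<-trans (n<1+n s) 1+s<M) | indicator-yes (suc s <? M) 1+s<M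
                               | indicator-no (M ≟ suc s) (≢-sym (<⇒≢ 1+s<M)) = refl

    rootPrefix-difference : ∀ {a b a′ b′ s} → b ≤ n + n → b′ ≤ n + n → suc s ≤ n →
      rootVector n a b ⊖ rootVector n a′ b′ ≡ rootVector n s (suc s) →
      ∀ M → M ≤ n → rootPrefix a b M -ℤ rootPrefix a′ b′ M ≡ δ M (suc s)
    rootPrefix-difference {a} {b} {a′} {b′} {s} b≤2n b′≤2n 1+s≤n e M M≤n = begin
      rootPrefix a b M -ℤ rootPrefix a′ b′ M
        ≡⟨ cong₂ _-ℤ_ (prefixSum-rootCoordinate a b M b≤2n) (prefixSum-rootCoordinate a′ b′ M b′≤2n) ⟨
      prefixSum (rootCoordinate n a b) M -ℤ prefixSum (rootCoordinate n a′ b′) M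
        ≡⟨ prefixSum-sub (rootCoordinate n a b) (rootCoordinate n a′ b′) M ⟩
      prefixSum (λ m → rootCoordinate n a b m -ℤ rootCoordinate n a′ b′ m) M
        ≡⟨ prefixSum-cong M (λ m m<M → ⊖-rootVector⁻ e m (<-≤-trans m<M M≤n)) ⟩
      prefixSum (rootCoordinate n s (suc s)) M
        ≡⟨ prefixSum-rootCoordinate s (suc s) M (≤-trans 1+s≤n (m≤m+n n n)) ⟩
      rootPrefix s (suc s) M
        ≡⟨ rootPrefix-simple s M 1+s≤n M≤n ⟩
      δ M (suc s) ∎
      where open ≡-Reasoning

    n∸a+n∸[2n∸b]≡b∸a+n∸b : ∀ {a b} → a < b → a + b ≤ n + n → (n ∸ a) + (n ∸ (n + n ∸ b)) ≡ (b ∸ a) + (n ∸ b)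
    n∸a+n∸[2n∸b]≡b∸a+n∸b {a} {b} a<b a+b≤2n with ≤-<-connex b n
    ... | inj₁ b≤n = trans (cong₂ _+_ n∸a≡r+t n∸[2n∸b]≡0) (+-identityʳ _)
      where
        r = b ∸ a
        t = n ∸ b
        n∸a≡r+t : n ∸ a ≡ r + t
        n∸a≡r+t = trans (cong (_∸ a) (sym (trans (sym (+-assoc a r t))
                          (trans (cong (_+ t) (m+[n∸m]≡n (<⇒≤ a<b))) (m+[n∸m]≡n b≤n)))))
                        (m+n∸m≡n a (r + t))
        n∸[2n∸b]≡0 : n ∸ (n + n ∸ b) ≡ 0
        n∸[2n∸b]≡0 = m≤n⇒m∸n≡0 (a+b≡c+d∧a≤c⇒d≤b (m+[n∸m]≡n (≤-trans b≤n (m≤m+n n n))) b≤n)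
    ... | inj₂ n<b = begin
      (n ∸ a) + (n ∸ (n + n ∸ b))   ≡⟨ cong (λ z → (n ∸ a) + z) n∸[2n∸b]≡u ⟩
      (n ∸ a) + u                   ≡⟨ +-∸-comm u a≤n ⟨
      (n + u) ∸ a                   ≡⟨ cong (_∸ a) n+u≡b ⟩
      b ∸ a                         ≡⟨ +-identityʳ (b ∸ a) ⟨
      (b ∸ a) + 0                   ≡⟨ cong (λ z → (b ∸ a) + z) (m≤n⇒m∸n≡0 (<⇒≤ n<b)) ⟨
      (b ∸ a) + (n ∸ b)             ∎
      where
        open ≡-Reasoning
        u = b ∸ n
        n+u≡b : n + u ≡ b
        n+u≡b = m+[n∸m]≡n (<⇒≤ n<b)
        u≤n : u ≤ n
        u≤n = +-cancelˡ-≤ n u n (≤-trans (≤-reflexive n+u≡b) (m+n≤o⇒n≤o a a+b≤2n))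
        n∸[2n∸b]≡u : n ∸ (n + n ∸ b) ≡ u
        n∸[2n∸b]≡u = trans (cong (λ z → n ∸ (n + n ∸ z)) (sym n+u≡b))
                           (trans (cong (n ∸_) ([m+n]∸[m+o]≡n∸o n n u)) (m∸[m∸n]≡n u≤n))
        a≤n : a ≤ n
        a≤n = <⇒≤ (a<b∧a+b≤2n⇒a<n a<b a+b≤2n)

    -- Summing the prefix sums over M = 1 … n evaluates the height functional Σₖ (n − k) xₖ, which is
    -- b − a on rootVector n a b and 1 on every simple root.
    rootPrefix-total : ∀ {a b} → a < b → a + b ≤ n + n → prefixSum (λ M → rootPrefix a b (suc M)) n ≡ + (b ∸ a)
    rootPrefix-total {a} {b} a<b a+b≤2n = begin
      prefixSum (λ M → rootPrefix a b (suc M)) n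
        ≡⟨ prefixSum-sub-add (λ M → indicator (a <? suc M)) (λ M → indicator (b <? suc M)) (λ M → indicator (n + n ∸ b <? suc M)) n ⟩
      (prefixSum (λ M → indicator (a <? suc M)) n -ℤ prefixSum (λ M → indicator (b <? suc M)) n)
        +ℤ prefixSum (λ M → indicator (n + n ∸ b <? suc M)) n
        ≡⟨ cong₂ _+ℤ_ (cong₂ _-ℤ_ (prefixSum-[<1+] a n) (prefixSum-[<1+] b n)) (prefixSum-[<1+] (n + n ∸ b) n) ⟩
      (+ (n ∸ a) -ℤ + (n ∸ b)) +ℤ + (n ∸ (n + n ∸ b))
        ≡⟨ +x-+y++z≡+w (n ∸ a) (n ∸ b) (n ∸ (n + n ∸ b)) (b ∸ a) (n∸a+n∸[2n∸b]≡b∸a+n∸b a<b a+b≤2n) ⟩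
      + (b ∸ a) ∎
      where open ≡-Reasoning

    rootPrefix-≤lead : ∀ {a b M} → M ≤ a → a < b → a + b ≤ n + n → rootPrefix a b M ≡ 0ℤ
    rootPrefix-≤lead {a} {b} {M} M≤a a<b a+b≤2n
      rewrite indicator-no (a <? M) (λ a<M → <⇒≱ a<M M≤a)
            | indicator-no (b <? M) (λ b<M → <⇒≱ b<M (≤-trans M≤a (<⇒≤ a<b)))
            | indicator-no (n + n ∸ b <? M) (λ lt → <⇒≱ lt (≤-trans M≤a (m+n≤o⇒m≤o∸n a a+b≤2n))) = refl

    rootPrefix-past-lead : ∀ {a b M} → a < M → ¬ b < M → rootPrefix a b M ≡ (1ℤ -ℤ 0ℤ) +ℤ indicator (n + n ∸ b <? M)
    rootPrefix-past-lead {a} {b} {M} a<M b≮M =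
      cong₂ (λ u v → (u -ℤ v) +ℤ indicator (n + n ∸ b <? M)) (indicator-yes (a <? M) a<M) (indicator-no (b <? M) b≮M)

    rootPrefix-2+lead≡0⇒b<2+a : ∀ {a b} → rootPrefix a b (2 + a) ≡ 0ℤ → b < 2 + a
    rootPrefix-2+lead≡0⇒b<2+a {a} {b} e with b <? 2 + a
    ... | yes b<2+a = b<2+a
    ... | no  b≮2+a = ⊥-elim (1+indicator≢0 (n + n ∸ b <? 2 + a)
                        (trans (sym (rootPrefix-past-lead (m<n⇒m<1+n (n<1+n a)) b≮2+a)) e))
      where
        1+indicator≢0 : ∀ {A : Set} (a? : Dec A) → (1ℤ -ℤ 0ℤ) +ℤ indicator a? ≢ 0ℤ
        1+indicator≢0 (yes _) ()
        1+indicator≢0 (no  _) ()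

    module _ {a b a′ b′ s : ℕ} (a<b : a < b) (a+b≤2n : a + b ≤ n + n) (a′<b′ : a′ < b′) (a′+b′≤2n : a′ + b′ ≤ n + n)
             (1+s≤n : suc s ≤ n) (e : rootVector n a b ⊖ rootVector n a′ b′ ≡ rootVector n s (suc s)) where

      private
        difference : ∀ M → M ≤ n → rootPrefix a b M -ℤ rootPrefix a′ b′ M ≡ δ M (suc s)
        difference = rootPrefix-difference (m+n≤o⇒n≤o a a+b≤2n) (m+n≤o⇒n≤o a′ a′+b′≤2n) 1+s≤n e

        a<n : a < n
        a<n = a<b∧a+b≤2n⇒a<n a<b a+b≤2n

        a′<n : a′ < n
        a′<n = a<b∧a+b≤2n⇒a<n a′<b′ a′+b′≤2n

      rank-difference : b ∸ a ≡ suc (b′ ∸ a′)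
      rank-difference = +x-+y≡1⇒x≡1+y (b ∸ a) (b′ ∸ a′) (begin
        + (b ∸ a) -ℤ + (b′ ∸ a′)
          ≡⟨ cong₂ _-ℤ_ (rootPrefix-total a<b a+b≤2n) (rootPrefix-total a′<b′ a′+b′≤2n) ⟨
        prefixSum (λ M → rootPrefix a b (suc M)) n -ℤ prefixSum (λ M → rootPrefix a′ b′ (suc M)) n
          ≡⟨ prefixSum-sub (λ M → rootPrefix a b (suc M)) (λ M → rootPrefix a′ b′ (suc M)) n ⟩
        prefixSum (λ M → rootPrefix a b (suc M) -ℤ rootPrefix a′ b′ (suc M)) n
          ≡⟨ prefixSum-cong n (λ m m<n → difference (suc m) m<n) ⟩
        prefixSum (λ m → δ m s) n
          ≡⟨ prefixSum-δ s n ⟩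
        indicator (s <? n)
          ≡⟨ indicator-yes (s <? n) 1+s≤n ⟩
        1ℤ ∎)
        where open ≡-Reasoning

      private
        lead-not-below : ¬ a′ < a
        lead-not-below a′<a = negative≢indicator (n + n ∸ b′ <? suc a′) (suc a′ ≟ suc s)
          (trans (sym (cong₂ _-ℤ_ (rootPrefix-≤lead a′<a a<b a+b≤2n)
                                  (rootPrefix-past-lead (n<1+n a′) (λ b′<1+a′ → <⇒≱ b′<1+a′ a′<b′))))
                 (difference (suc a′) (≤-trans a′<a (<⇒≤ a<n))))
          where
            negative≢indicator : ∀ {A B : Set} (a? : Dec A) (b? : Dec B) →
                                 0ℤ -ℤ ((1ℤ -ℤ 0ℤ) +ℤ indicator a?) ≢ indicator b?
            negative≢indicator (yes _) (yes _) ()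
            negative≢indicator (yes _) (no  _) ()
            negative≢indicator (no  _) (yes _) ()
            negative≢indicator (no  _) (no  _) ()

        lead-not-beyond : ¬ suc a < a′
        lead-not-beyond 1+a<a′ = <⇒≱ a′<b′ (m∸n≡0⇒m≤n (suc-injective (trans (sym rank-difference) b∸a≡1)))
          where
            positive≡indicator : ∀ {A B : Set} (a? : Dec A) (b? : Dec B) →
                                 ((1ℤ -ℤ 0ℤ) +ℤ indicator a?) -ℤ 0ℤ ≡ indicator b? → B
            positive≡indicator (no  _) (yes b) _ = b
            positive≡indicator (yes _) (yes _) ()
            positive≡indicator (yes _) (no  _) ()
            positive≡indicator (no  _) (no  _) ()
            1+a≡1+s : suc a ≡ suc s
            1+a≡1+s = positive≡indicator (n + n ∸ b <? suc a) (suc a ≟ suc s)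
              (trans (sym (cong₂ _-ℤ_ (rootPrefix-past-lead (n<1+n a) (λ b<1+a → <⇒≱ b<1+a a<b))
                                      (rootPrefix-≤lead (<⇒≤ 1+a<a′) a′<b′ a′+b′≤2n)))
                     (difference (suc a) a<n))
            prefix≡0 : rootPrefix a b (2 + a) ≡ 0ℤ
            prefix≡0 = begin
              rootPrefix a b (2 + a)
                ≡⟨ ℤ.+-identityʳ _ ⟨
              rootPrefix a b (2 + a) -ℤ 0ℤ
                ≡⟨ cong (rootPrefix a b (2 + a) -ℤ_) (rootPrefix-≤lead 1+a<a′ a′<b′ a′+b′≤2n) ⟨
              rootPrefix a b (2 + a) -ℤ rootPrefix a′ b′ (2 + a)
                ≡⟨ difference (2 + a) (≤-trans 1+a<a′ (<⇒≤ a′<n)) ⟩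
              δ (2 + a) (suc s)
                ≡⟨ indicator-no (2 + a ≟ suc s) (λ 2+a≡1+s → <⇒≢ (n<1+n (suc a)) (sym (trans 2+a≡1+s (sym 1+a≡1+s)))) ⟩
              0ℤ ∎
              where open ≡-Reasoning
            b∸a≡1 : b ∸ a ≡ 1
            b∸a≡1 = trans (cong (_∸ a) (≤-antisym (≤-pred (rootPrefix-2+lead≡0⇒b<2+a prefix≡0)) a<b)) (m+n∸n≡m 1 a)

      lead-difference : a′ ≡ a ⊎ a′ ≡ suc a
      lead-difference with <-cmp a′ a
      ... | tri< a′<a _ _ = ⊥-elim (lead-not-below a′<a)
      ... | tri≈ _ a′≡a _ = inj₁ a′≡a
      ... | tri> _ _ a<a′ with <-cmp a′ (suc a)
      ...   | tri< a′<1+a _ _ = ⊥-elim (<⇒≱ a<a′ (≤-pred a′<1+a))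
      ...   | tri≈ _ a′≡1+a _ = inj₂ a′≡1+a
      ...   | tri> _ _ 1+a<a′ = ⊥-elim (lead-not-beyond 1+a<a′)

module RootPoset where

  open import Defs
  open RootVectors
  open RootPairs
  open CoverElimination

  open import Data.Fin using (Fin)
  open import Data.List.Membership.Propositional using (_∈_)
  open import Data.Nat
  open import Data.Nat.Properties
  open import Data.Product using (Σ; _,_; _×_; proj₁; proj₂)
  open import Data.Sum using (_⊎_; inj₁; inj₂)
  open import Relation.Binary.PropositionalEquality
    using (_≡_; sym; trans; cong; cong₂; subst; module ≡-Reasoning)

  module _ (n : ℕ) where

    lead rank : Fin (N n) → ℕ
    lead p = proj₁ (rootPair n p)
    rank p = proj₂ (rootPair n p) ∸ lead p

    lead+rank≡ : ∀ p → lead p + rank p ≡ proj₂ (rootPair n p)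
    lead+rank≡ p = m+[n∸m]≡n (<⇒≤ (proj₁ (rootPair-valid n p)))

    rank-lead-bounds : ∀ p → 1 ≤ rank p × lead p + lead p + rank p ≤ n + n
    rank-lead-bounds p = m<n⇒0<n∸m (proj₁ (rootPair-valid n p)) ,
      ≤-trans (≤-reflexive (trans (+-assoc (lead p) (lead p) (rank p)) (cong (lead p +_) (lead+rank≡ p))))
              (proj₂ (rootPair-valid n p))

    root-at : ∀ a r → 1 ≤ r → a + a + r ≤ n + n → Σ (Fin (N n)) λ p → lead p ≡ a × rank p ≡ r
    root-at a r 1≤r 2a+r≤2n with rootPair-surjective n a (a + r) (m<m+n a 1≤r) (≤-trans (≤-reflexive (sym (+-assoc a a r))) 2a+r≤2n)
    ... | p , p↦ab = p , cong proj₁ p↦ab , trans (cong₂ _∸_ (cong proj₂ p↦ab) (cong proj₁ p↦ab)) (m+n∸m≡n a r)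

    lead-rank-injective : ∀ {p q} → lead p ≡ lead q → rank p ≡ rank q → p ≡ q
    lead-rank-injective {p} {q} lp≡lq rp≡rq = rootPair-injective n
      (cong₂ _,_ lp≡lq (trans (sym (lead+rank≡ p)) (trans (cong₂ _+_ lp≡lq rp≡rq) (lead+rank≡ q))))

    root≡rootVector-lead-rank : ∀ p → root n p ≡ rootVector n (lead p) (lead p + rank p)
    root≡rootVector-lead-rank p = trans (root≡rootVector n p) (cong (rootVector n (lead p)) (sym (lead+rank≡ p)))

    lead<n : ∀ p → lead p < n
    lead<n p = a<b∧a+b≤2n⇒a<n (proj₁ (rootPair-valid n p)) (proj₂ (rootPair-valid n p))

    lead+[lead+rank]≤2n : ∀ p → lead p + (lead p + rank p) ≤ n + n
    lead+[lead+rank]≤2n p = subst (λ b → lead p + b ≤ n + n) (sym (lead+rank≡ p)) (proj₂ (rootPair-valid n p))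

    private
      lead-step-simple : ∀ a b → a < n → rootVector n a b ⊖ rootVector n (suc a) b ∈ simpleRoots n
      lead-step-simple a b a<n = subst (_∈ simpleRoots n) (sym (rootVector-lead-step a b a<n)) (∈-simpleRoots⁺ a a<n)

      rank-step-simple : ∀ a b → a + suc b ≤ n + n → rootVector n a (suc b) ⊖ rootVector n a b ∈ simpleRoots n
      rank-step-simple a b a+1+b≤2n with ≤-<-connex (suc b) n
      ... | inj₁ 1+b≤n = subst (_∈ simpleRoots n) (sym (rootVector-rank-step a b 1+b≤n)) (∈-simpleRoots⁺ b 1+b≤n)
      ... | inj₂ n<1+b = subst (_∈ simpleRoots n) (sym (rootVector-reflected-rank-step a b (≤-pred n<1+b) 1+b≤2n))
                               (∈-simpleRoots⁺ (n + n ∸ suc b) 1+s≤n)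
        where
          1+b≤2n : suc b ≤ n + n
          1+b≤2n = m+n≤o⇒n≤o a a+1+b≤2n
          1+s≤n : suc (n + n ∸ suc b) ≤ n
          1+s≤n = subst (_≤ n) (m∸n≡1+m∸[1+n] 1+b≤2n)
                    (≤-trans (∸-monoʳ-≤ (n + n) (≤-pred n<1+b)) (≤-reflexive (m+n∸n≡m n n)))

    Covers-next-lead⁺ : ∀ p q → lead q ≡ suc (lead p) → rank p ≡ suc (rank q) → Covers n p q
    Covers-next-lead⁺ p q lq≡1+lp rp≡1+rq =
      subst (_∈ simpleRoots n)
            (sym (cong₂ _⊖_ (root≡rootVector-lead-rank p)
                            (trans (root≡rootVector-lead-rank q) (cong₂ (rootVector n) lq≡1+lp bq≡bp))))
            (lead-step-simple (lead p) (lead p + rank p) (lead<n p))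
      where
        bq≡bp : lead q + rank q ≡ lead p + rank p
        bq≡bp = trans (cong (_+ rank q) lq≡1+lp) (trans (sym (+-suc (lead p) (rank q))) (cong (lead p +_) (sym rp≡1+rq)))

    Covers-same-lead⁺ : ∀ p q → lead q ≡ lead p → rank p ≡ suc (rank q) → Covers n p q
    Covers-same-lead⁺ p q lq≡lp rp≡1+rq =
      subst (_∈ simpleRoots n)
            (sym (cong₂ _⊖_ (trans (root≡rootVector-lead-rank p) (cong₂ (rootVector n) (sym lq≡lp) bp≡1+bq))
                            (root≡rootVector-lead-rank q)))
            (rank-step-simple (lead q) (lead q + rank q)
               (subst (_≤ n + n) (cong₂ _+_ (sym lq≡lp) bp≡1+bq) (lead+[lead+rank]≤2n p)))
      where
        bp≡1+bq : lead p + rank p ≡ suc (lead q + rank q)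
        bp≡1+bq = trans (cong₂ _+_ (sym lq≡lp) rp≡1+rq) (+-suc (lead q) (rank q))

    Covers⁻ : ∀ p q → Covers n p q → rank p ≡ suc (rank q) × (lead q ≡ lead p ⊎ lead q ≡ suc (lead p))
    Covers⁻ p q p⋗q with ∈-simpleRoots⁻ p⋗q
    ... | s , 1+s≤n , difference =
      rank-difference n a<b a+b≤2n a′<b′ a′+b′≤2n 1+s≤n e , lead-difference n a<b a+b≤2n a′<b′ a′+b′≤2n 1+s≤n e
      where
        a<b = proj₁ (rootPair-valid n p)
        a+b≤2n = proj₂ (rootPair-valid n p)
        a′<b′ = proj₁ (rootPair-valid n q)
        a′+b′≤2n = proj₂ (rootPair-valid n q)
        e = trans (sym (cong₂ _⊖_ (root≡rootVector n p) (root≡rootVector n q))) difference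

    Covers⇒rank< : ∀ {a b} → Covers n a b → rank b < rank a
    Covers⇒rank< {a} {b} a⋗b = ≤-reflexive (sym (proj₁ (Covers⁻ a b a⋗b)))

module IdealsOfPaths where

  open import Defs

  open RootPoset
  open BallotPaths
  open UpperSets

  open import Data.Bool using (Bool)
  open import Data.Empty using (⊥-elim)
  open import Data.Fin using (Fin)
  open import Data.Fin.Subset using (Subset; _∈_; _∉_)
  open import Data.List using (List; length)
  open import Data.Nat
  open import Data.Nat.Properties
  open import Data.Nat.Tactic.RingSolver using (solve-∀)
  open import Data.Product using (Σ; _,_; _×_; proj₁; proj₂)
  open import Data.Sum using (_⊎_; inj₁; inj₂)
  open import Relation.Binary.Definitions using (tri<; tri≈; tri>)
  open import Relation.Binary.PropositionalEquality
    using (_≡_; _≢_; refl; sym; trans; cong; cong₂; subst; module ≡-Reasoning)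

  1+2x≢2y : ∀ x y → suc (x + x) ≢ y + y
  1+2x≢2y zero    zero    ()
  1+2x≢2y zero    (suc y) e = 0≢1+n (trans (suc-injective e) (+-suc y y))
  1+2x≢2y (suc x) zero    ()
  1+2x≢2y (suc x) (suc y) e =
    1+2x≢2y x y (suc-injective (trans (cong suc (sym (+-suc x x))) (trans (suc-injective e) (+-suc y y))))

  same-parity∧adjacent⇒≡ : ∀ {A B} d e → A + d + d ≡ B + e + e → A ≤ suc B → B ≤ suc A → A ≡ B
  same-parity∧adjacent⇒≡ {A} {B} d e A+2d≡B+2e A≤1+B B≤1+A with <-cmp A B
  ... | tri≈ _ A≡B _ = A≡B
  ... | tri< A<B _ _ = ⊥-elim (1+2x≢2y e d (sym (+-cancelˡ-≡ A _ _ (begin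
    A + (d + d)       ≡⟨ +-assoc A d d ⟨
    A + d + d         ≡⟨ A+2d≡B+2e ⟩
    B + e + e         ≡⟨ cong (λ z → z + e + e) (≤-antisym B≤1+A A<B) ⟩
    suc (A + e + e)   ≡⟨ cong suc (+-assoc A e e) ⟩
    suc (A + (e + e)) ≡⟨ +-suc A (e + e) ⟨
    A + suc (e + e)   ∎))))
    where open ≡-Reasoning
  ... | tri> _ _ B<A = ⊥-elim (1+2x≢2y d e (sym (+-cancelˡ-≡ B _ _ (begin
    B + (e + e)       ≡⟨ +-assoc B e e ⟨
    B + e + e         ≡⟨ A+2d≡B+2e ⟨
    A + d + d         ≡⟨ cong (λ z → z + d + d) (≤-antisym A≤1+B B<A) ⟩
    suc (B + d + d)   ≡⟨ cong suc (+-assoc B d d) ⟩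
    suc (B + (d + d)) ≡⟨ +-suc B (d + d) ⟨
    B + suc (d + d)   ∎))))
    where open ≡-Reasoning

  d+d+r≡r+d+d : ∀ d r → d + d + r ≡ r + d + d
  d+d+r≡r+d+d d r = trans (+-comm (d + d) r) (sym (+-assoc r d d))

  half-injective : ∀ {x y} → x + x ≡ y + y → x ≡ y
  half-injective {x} {y} e = trans (n≡⌊n+n/2⌋ x) (trans (cong ⌊_/2⌋ e) (sym (n≡⌊n+n/2⌋ y)))

  module _ (n : ℕ) where

    pathLength : ℕ
    pathLength = suc (n + n)

    -- The roots with rank r and lead a sit in column 2a + r + 1 of the strip 1 … 2n + 1; a ballot
    -- path cuts off the roots lying on or above it.
    column : Fin (N n) → ℕ
    column j = lead n j + lead n j + suc (rank n j)

    idealOf : List Bool → Subset (N n)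
    idealOf w = subsetOf (λ j → heightAt w 0 (column j) ≤? rank n j)

    ∈-idealOf⁺ : ∀ w j → heightAt w 0 (column j) ≤ rank n j → j ∈ idealOf w
    ∈-idealOf⁺ w j = ∈-subsetOf⁺ (λ j → heightAt w 0 (column j) ≤? rank n j)

    ∈-idealOf⁻ : ∀ w j → j ∈ idealOf w → heightAt w 0 (column j) ≤ rank n j
    ∈-idealOf⁻ w j = ∈-subsetOf⁻ (λ j → heightAt w 0 (column j) ≤? rank n j)

    column≤pathLength : ∀ j → column j ≤ pathLength
    column≤pathLength j = ≤-trans (≤-reflexive (+-suc (lead n j + lead n j) (rank n j))) (s≤s (proj₂ (rank-lead-bounds n j)))

    adjacent-columns : ∀ {p q} → rank n p ≡ suc (rank n q) → lead n q ≡ lead n p ⊎ lead n q ≡ suc (lead n p) →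
      column p ≡ suc (column q) ⊎ column q ≡ suc (column p)
    adjacent-columns {p} {q} rp≡1+rq (inj₁ lq≡lp) = inj₁ (begin
      lead n p + lead n p + suc (rank n p)             ≡⟨ cong (λ r → lead n p + lead n p + suc r) rp≡1+rq ⟩
      lead n p + lead n p + suc (suc (rank n q))       ≡⟨ +-suc (lead n p + lead n p) (suc (rank n q)) ⟩
      suc (lead n p + lead n p + suc (rank n q))       ≡⟨ cong (λ a → suc (a + a + suc (rank n q))) lq≡lp ⟨
      suc (column q)                                   ∎)
      where open ≡-Reasoning
    adjacent-columns {p} {q} rp≡1+rq (inj₂ lq≡1+lp) = inj₂ (begin
      lead n q + lead n q + suc (rank n q)             ≡⟨ cong (λ a → a + a + suc (rank n q)) lq≡1+lp ⟩
      suc (lead n p) + suc (lead n p) + suc (rank n q) ≡⟨ shift (lead n p) (rank n q) ⟩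
      suc (lead n p + lead n p + suc (suc (rank n q))) ≡⟨ cong (λ r → suc (lead n p + lead n p + suc r)) rp≡1+rq ⟨
      suc (column p)                                   ∎)
      where
        open ≡-Reasoning
        shift : ∀ a r → suc a + suc a + suc r ≡ suc (a + a + suc (suc r))
        shift = solve-∀

    column-suc : ∀ {j x} → column j ≡ suc x → lead n j + lead n j + rank n j ≡ x
    column-suc {j} cj = suc-injective (trans (sym (+-suc (lead n j + lead n j) (rank n j))) cj)

    private
      shift : ∀ a r → suc a + suc a + r ≡ suc (suc (a + a + r))
      shift = solve-∀

    covered-in-previous-column : ∀ {j x} → column j ≡ suc x → 2 ≤ rank n j →
      Σ (Fin (N n)) λ q → column q ≡ x × suc (rank n q) ≡ rank n j × Covers n j q
    covered-in-previous-column {j} {x} cj 2≤r = q , column-q , 1+rq≡r , Covers-same-lead⁺ n j q lq≡a (sym 1+rq≡r)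
      where
        a = lead n j
        r = rank n j
        at = root-at n a (r ∸ 1) (∸-monoˡ-≤ 1 2≤r) (≤-trans (+-monoʳ-≤ (a + a) (m∸n≤m r 1)) (proj₂ (rank-lead-bounds n j)))
        q = proj₁ at
        lq≡a = proj₁ (proj₂ at)
        1+rq≡r : suc (rank n q) ≡ r
        1+rq≡r = trans (cong suc (proj₂ (proj₂ at))) (m+[n∸m]≡n {1} (≤-trans (s≤s z≤n) 2≤r))
        column-q : column q ≡ x
        column-q = trans (cong₂ (λ a r → a + a + r) lq≡a 1+rq≡r) (column-suc cj)

    covering-in-previous-column : ∀ {j x} → column j ≡ suc x → 1 ≤ lead n j →
      Σ (Fin (N n)) λ q → column q ≡ x × rank n q ≡ suc (rank n j) × Covers n q j
    covering-in-previous-column {j} {x} cj 1≤a = q , column-q , rq≡1+r ,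
      Covers-next-lead⁺ n q j (trans (sym 1+a′≡a) (cong suc (sym lq≡a′))) rq≡1+r
      where
        a = lead n j
        r = rank n j
        a′ = pred a
        1+a′≡a : suc a′ ≡ a
        1+a′≡a = suc-pred a {{>-nonZero 1≤a}}
        2a′+r+2≡2a+r : suc (suc (a′ + a′ + r)) ≡ a + a + r
        2a′+r+2≡2a+r = trans (sym (shift a′ r)) (cong (λ a → a + a + r) 1+a′≡a)
        at = root-at n a′ (suc r) (s≤s z≤n) (≤-trans (≤-reflexive (+-suc (a′ + a′) r))
               (≤-trans (n≤1+n _) (≤-trans (≤-reflexive 2a′+r+2≡2a+r) (proj₂ (rank-lead-bounds n j)))))
        q = proj₁ at
        lq≡a′ = proj₁ (proj₂ at)
        rq≡1+r = proj₂ (proj₂ at)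
        column-q : column q ≡ x
        column-q = trans (cong₂ (λ a r → a + a + suc r) lq≡a′ rq≡1+r)
                     (trans (+-suc (a′ + a′) (suc r)) (trans (cong suc (+-suc (a′ + a′) r)) (trans 2a′+r+2≡2a+r (column-suc cj))))

    covering-in-next-column : ∀ {j} → column j ≤ n + n →
      Σ (Fin (N n)) λ q → column q ≡ suc (column j) × rank n q ≡ suc (rank n j) × Covers n q j
    covering-in-next-column {j} cj≤2n = q , column-q , rq≡1+r , Covers-same-lead⁺ n q j (sym lq≡a) rq≡1+r
      where
        a = lead n j
        r = rank n j
        at = root-at n a (suc r) (s≤s z≤n) cj≤2n
        q = proj₁ at
        lq≡a = proj₁ (proj₂ at)
        rq≡1+r = proj₂ (proj₂ at)
        column-q : column q ≡ suc (column j)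
        column-q = trans (cong₂ (λ a r → a + a + suc r) lq≡a rq≡1+r) (+-suc (a + a) (suc r))

    Covers⇒adjacent-columns : ∀ {p q} → Covers n p q → column p ≡ suc (column q) ⊎ column q ≡ suc (column p)
    Covers⇒adjacent-columns {p} {q} p⋗q = adjacent-columns (proj₁ (Covers⁻ n p q p⋗q)) (proj₂ (Covers⁻ n p q p⋗q))

    idealOf-IsUpperSet : ∀ w → IsUpperSet (Covers n) (idealOf w)
    idealOf-IsUpperSet w = ⋗-closed⇒IsUpperSet (Covers n) closed
      where
        closed : ∀ a b → b ∈ idealOf w → Covers n a b → a ∈ idealOf w
        closed a b b∈ a⋗b = ∈-idealOf⁺ w a (subst (heightAt w 0 (column a) ≤_) (sym (proj₁ (Covers⁻ n a b a⋗b)))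
                                              (height≤ (Covers⇒adjacent-columns a⋗b)))
          where
            hb = ∈-idealOf⁻ w b b∈
            height≤ : column a ≡ suc (column b) ⊎ column b ≡ suc (column a) → heightAt w 0 (column a) ≤ suc (rank n b)
            height≤ (inj₁ ca≡1+cb) = ≤-trans (≤-reflexive (cong (heightAt w 0) ca≡1+cb))
                                             (≤-trans (heightAt-suc-≤ w 0 (column b)) (s≤s hb))
            height≤ (inj₂ cb≡1+ca) = ≤-trans (heightAt-≤-suc w 0 (column a))
                                             (s≤s (≤-trans (≤-reflexive (cong (heightAt w 0) (sym cb≡1+ca))) hb))

    root-at-column : ∀ x A d → A + d + d ≡ x → x ≤ pathLength → 2 ≤ A →
      Σ (Fin (N n)) λ j → column j ≡ x × suc (rank n j) ≡ A × lead n j ≡ d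
    root-at-column x (suc r) d A+2d≡x x≤ (s≤s 1≤r)
      with root-at n d r 1≤r (≤-pred (≤-trans (≤-reflexive (cong suc (d+d+r≡r+d+d d r))) (≤-trans (≤-reflexive A+2d≡x) x≤)))
    ... | j , lj≡d , rj≡r = j , trans (cong₂ (λ a r → a + a + suc r) lj≡d rj≡r) (trans (d+d+r≡r+d+d d (suc r)) A+2d≡x) ,
                                cong suc rj≡r , lj≡d

    heightAt<⇒idealOf≢ : ∀ {w w′ x} → IsBallot 0 w → IsBallot 0 w′ → length w ≡ pathLength → length w′ ≡ pathLength →
      x ≤ pathLength → heightAt w 0 x < heightAt w′ 0 x → idealOf w ≢ idealOf w′
    heightAt<⇒idealOf≢ {w} {w′} {x} w-ballot w′-ballot |w| |w′| x≤ B<A w≡w′ = j∉idealOf-w′ (subst (j ∈_) w≡w′ j∈idealOf-w)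
      where
        B = heightAt w 0 x
        A = heightAt w′ 0 x
        B+2d≡x : B + downSteps w x + downSteps w x ≡ x
        B+2d≡x = heightAt+downSteps w 0 x w-ballot (subst (x ≤_) (sym |w|) x≤)
        A+2d′≡x : A + downSteps w′ x + downSteps w′ x ≡ x
        A+2d′≡x = heightAt+downSteps w′ 0 x w′-ballot (subst (x ≤_) (sym |w′|) x≤)
        2+B≤A : suc (suc B) ≤ A
        2+B≤A = ≤∧≢⇒< B<A λ 1+B≡A → <-irrefl (sym (same-parity∧adjacent⇒≡ _ _ (trans A+2d′≡x (sym B+2d≡x))
                                                     (≤-reflexive (sym 1+B≡A)) (≤-trans (<⇒≤ B<A) (n≤1+n A)))) B<A
        at = root-at-column x A (downSteps w′ x) A+2d′≡x x≤ (≤-trans (s≤s (s≤s z≤n)) 2+B≤A)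
        j = proj₁ at
        column-j≡x = proj₁ (proj₂ at)
        1+rank-j≡A = proj₁ (proj₂ (proj₂ at))
        j∈idealOf-w : j ∈ idealOf w
        j∈idealOf-w = ∈-idealOf⁺ w j (subst (λ y → heightAt w 0 y ≤ rank n j) (sym column-j≡x)
                                        (≤-pred (≤-trans (n≤1+n (suc B)) (≤-trans 2+B≤A (≤-reflexive (sym 1+rank-j≡A))))))
        j∉idealOf-w′ : j ∉ idealOf w′
        j∉idealOf-w′ j∈ = <-irrefl refl (subst (_≤ rank n j) (trans (cong (heightAt w′ 0) column-j≡x) (sym 1+rank-j≡A))
                                               (∈-idealOf⁻ w′ j j∈))

    idealOf-injective : ∀ {w w′} → IsBallot 0 w → IsBallot 0 w′ → length w ≡ pathLength → length w′ ≡ pathLength →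
      idealOf w ≡ idealOf w′ → w ≡ w′
    idealOf-injective {w} {w′} w-ballot w′-ballot |w| |w′| w≡w′ = heightAt-injective w w′ (trans |w| (sym |w′|)) same-heights
      where
        same-heights : ∀ x → x ≤ length w → heightAt w 0 x ≡ heightAt w′ 0 x
        same-heights x x≤ with <-cmp (heightAt w 0 x) (heightAt w′ 0 x)
        ... | tri< B<A _ _ = ⊥-elim (heightAt<⇒idealOf≢ w-ballot w′-ballot |w| |w′| (subst (x ≤_) |w| x≤) B<A w≡w′)
        ... | tri≈ _ B≡A _ = B≡A
        ... | tri> _ _ A<B = ⊥-elim (heightAt<⇒idealOf≢ w′-ballot w-ballot |w′| |w| (subst (x ≤_) |w| x≤) A<B (sym w≡w′))

module PathsOfIdeals where

  open import Defs
  open RootPoset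
  open BallotPaths
  open UpperSets
  open IdealsOfPaths

  open import Data.Bool using (Bool; true; false; if_then_else_)
  open import Data.Empty using (⊥-elim)
  open import Data.Fin using (Fin)
  open import Data.Fin.Properties using (any?)
  open import Data.Fin.Subset using (Subset; _∈_; _∉_)
  open import Data.Fin.Subset.Properties using (_∈?_; ⊆-antisym)
  open import Data.List using (List; []; _∷_; length)
  open import Data.Nat
  open import Data.Nat.Properties
  open import Data.Nat.Tactic.RingSolver using (solve-∀)
  open import Data.Product using (Σ; ∃; _,_; _×_; proj₁; proj₂)
  open import Data.Unit using (tt)
  open import Relation.Binary.Definitions using (tri<; tri≈; tri>)
  open import Relation.Binary.PropositionalEquality
    using (_≡_; refl; sym; trans; cong; cong₂; subst; subst₂; module ≡-Reasoning)
  open import Relation.Nullary using (¬_; Dec; does; yes; no)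
  open import Relation.Nullary.Decidable using (_×-dec_)

  a+r≡b+h∧a+k≤b⇒h+k≤r : ∀ {a r b h k} → a + r ≡ b + h → a + k ≤ b → h + k ≤ r
  a+r≡b+h∧a+k≤b⇒h+k≤r {a} {r} {b} {h} {k} a+r≡b+h a+k≤b = ≤-trans (≤-reflexive (+-comm h k))
    (+-cancelˡ-≤ a (k + h) r (≤-trans (≤-reflexive (sym (+-assoc a k h)))
      (≤-trans (+-monoˡ-≤ h a+k≤b) (≤-reflexive (sym a+r≡b+h)))))

  a<b⇒a+a+2≤b+b : ∀ {a b} → a < b → a + a + 2 ≤ b + b
  a<b⇒a+a+2≤b+b {a} {b} a<b = ≤-trans (≤-reflexive (trans (+-comm (a + a) 2) (cong suc (sym (+-suc a a))))) (+-mono-≤ a<b a<b)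

  module _ (n : ℕ) where

    RootIn : Subset (N n) → ℕ → ℕ → Set
    RootIn S a r = ∃ λ j → lead n j ≡ a × rank n j ≡ r × j ∈ S

    rootIn? : ∀ S a r → Dec (RootIn S a r)
    rootIn? S a r = any? (λ j → (lead n j ≟ a) ×-dec (rank n j ≟ r) ×-dec (j ∈? S))

    RootIn⇒∈ : ∀ {S j} → RootIn S (lead n j) (rank n j) → j ∈ S
    RootIn⇒∈ {S} (k , lk≡lj , rk≡rj , k∈S) = subst (_∈ S) (lead-rank-injective n lk≡lj rk≡rj) k∈S

    -- After 2a + h + 1 steps, a of them down, the path is at height h + 1 just before the column of
    -- the root with lead a and rank h + 1; stepping down puts that root into the ideal, stepping up
    -- leaves it out.
    pathOf : Subset (N n) → ℕ → ℕ → ℕ → List Bool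
    pathOf S zero    h       a = []
    pathOf S (suc F) zero    a = true ∷ pathOf S F 1 a
    pathOf S (suc F) (suc h) a =
      if does (rootIn? S a (suc h)) then false ∷ pathOf S F h (suc a) else true ∷ pathOf S F (suc (suc h)) a

    pathOf-IsBallot : ∀ S F h a → IsBallot h (pathOf S F h a)
    pathOf-IsBallot S zero    h       a = tt
    pathOf-IsBallot S (suc F) zero    a = pathOf-IsBallot S F 1 a
    pathOf-IsBallot S (suc F) (suc h) a with does (rootIn? S a (suc h))
    ... | true  = pathOf-IsBallot S F h (suc a)
    ... | false = pathOf-IsBallot S F (suc (suc h)) a

    pathOf-length : ∀ S F h a → length (pathOf S F h a) ≡ F
    pathOf-length S zero    h       a = refl
    pathOf-length S (suc F) zero    a = cong suc (pathOf-length S F 1 a)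
    pathOf-length S (suc F) (suc h) a with does (rootIn? S a (suc h))
    ... | true  = cong suc (pathOf-length S F h (suc a))
    ... | false = cong suc (pathOf-length S F (suc (suc h)) a)

    ColumnAgrees : Subset (N n) → ℕ → ℕ → Set
    ColumnAgrees S x h = ∀ j → column n j ≡ x → (j ∈ S → h ≤ rank n j) × (h ≤ rank n j → j ∈ S)

    data NextColumnRoot (S : Subset (N n)) (h a : ℕ) (j : Fin (N n)) : Set where
      above : j ∈ S → suc (suc h) ≤ rank n j → NextColumnRoot S h a j
      level : rank n j ≡ h → lead n j ≡ a → NextColumnRoot S h a j
      below : j ∉ S → suc (suc (rank n j)) ≤ h → NextColumnRoot S h a j

    classify : ∀ {S x h a} → IsUpperSet (Covers n) S → x ≡ a + a + h → ColumnAgrees S x h →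
               ∀ j → column n j ≡ suc x → NextColumnRoot S h a j
    classify {S} {x} {h} {a} upper x≡2a+h agrees j cj with <-cmp (lead n j) a
    ... | tri< a′<a _ _ =
      let q , column-q , 1+rq≡r′ , j⋗q = covered-in-previous-column n cj (≤-trans (s≤s (s≤s z≤n)) 2+h≤r′)
          q∈S = proj₂ (agrees q column-q) (≤-pred (≤-trans (n≤1+n (suc h)) (≤-trans 2+h≤r′ (≤-reflexive (sym 1+rq≡r′)))))
      in above (IsUpperSet⇒⋗-closed (Covers n) upper j q q∈S j⋗q) 2+h≤r′
      where
        2+h≤r′ : suc (suc h) ≤ rank n j
        2+h≤r′ = ≤-trans (≤-reflexive (+-comm 2 h)) (a+r≡b+h∧a+k≤b⇒h+k≤r (trans (column-suc n cj) x≡2a+h) (a<b⇒a+a+2≤b+b a′<a))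
    ... | tri≈ _ a′≡a _ =
      level (+-cancelˡ-≡ (a + a) _ _ (trans (cong (λ a → a + a + rank n j) (sym a′≡a)) (trans (column-suc n cj) x≡2a+h))) a′≡a
    ... | tri> _ _ a<a′ = below j∉S 2+r′≤h
      where
        2+r′≤h : suc (suc (rank n j)) ≤ h
        2+r′≤h = ≤-trans (≤-reflexive (+-comm 2 (rank n j)))
                         (a+r≡b+h∧a+k≤b⇒h+k≤r (sym (trans (column-suc n cj) x≡2a+h)) (a<b⇒a+a+2≤b+b a<a′))
        j∉S : j ∉ S
        j∉S j∈S =
          let q , column-q , rq≡1+r′ , q⋗j = covering-in-previous-column n cj (≤-<-trans z≤n a<a′)
          in <⇒≱ 2+r′≤h (subst (h ≤_) rq≡1+r′ (proj₁ (agrees q column-q) (IsUpperSet⇒⋗-closed (Covers n) upper q j j∈S q⋗j)))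

    module _ {S : Subset (N n)} (upper : IsUpperSet (Covers n) S) where

      agrees-up-from-zero : ∀ {x a} → x ≡ a + a + 0 → ColumnAgrees S x 0 → ColumnAgrees S (suc x) 1
      agrees-up-from-zero {x} {a} x≡2a agrees j cj = from (classify upper x≡2a agrees j cj)
        where
          from : NextColumnRoot S 0 a j → (j ∈ S → 1 ≤ rank n j) × (1 ≤ rank n j → j ∈ S)
          from (above j∈S 2≤rj) = (λ _ → ≤-trans (s≤s z≤n) 2≤rj) , (λ _ → j∈S)
          from (level rj≡0 _)   = ⊥-elim (<-irrefl (sym rj≡0) (proj₁ (rank-lead-bounds n j)))
          from (below _ ())

      agrees-down : ∀ {x a h} → x ≡ a + a + suc h → ColumnAgrees S x (suc h) → RootIn S a (suc h) →
                    ColumnAgrees S (suc x) h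
      agrees-down {x} {a} {h} x≡ agrees root j cj = from (classify upper x≡ agrees j cj)
        where
          from : NextColumnRoot S (suc h) a j → (j ∈ S → h ≤ rank n j) × (h ≤ rank n j → j ∈ S)
          from (above j∈S 3+h≤rj)  = (λ _ → ≤-trans (m≤n+m h 3) 3+h≤rj) , (λ _ → j∈S)
          from (level rj≡1+h lj≡a) = (λ _ → ≤-trans (n≤1+n h) (≤-reflexive (sym rj≡1+h))) ,
                                     (λ _ → RootIn⇒∈ (subst₂ (RootIn S) (sym lj≡a) (sym rj≡1+h) root))
          from (below j∉S 2+rj≤1+h) = (λ j∈S → ⊥-elim (j∉S j∈S)) , (λ h≤rj → ⊥-elim (<-irrefl refl (≤-trans (≤-pred 2+rj≤1+h) h≤rj)))

      agrees-up : ∀ {x a h} → x ≡ a + a + suc h → ColumnAgrees S x (suc h) → ¬ RootIn S a (suc h) →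
                  ColumnAgrees S (suc x) (suc (suc h))
      agrees-up {x} {a} {h} x≡ agrees ¬root j cj = from (classify upper x≡ agrees j cj)
        where
          from : NextColumnRoot S (suc h) a j → (j ∈ S → suc (suc h) ≤ rank n j) × (suc (suc h) ≤ rank n j → j ∈ S)
          from (above j∈S 3+h≤rj)   = (λ _ → ≤-trans (n≤1+n _) 3+h≤rj) , (λ _ → j∈S)
          from (level rj≡1+h lj≡a)  = (λ j∈S → ⊥-elim (¬root (j , lj≡a , rj≡1+h , j∈S))) ,
                                      (λ 2+h≤rj → ⊥-elim (<-irrefl (sym rj≡1+h) 2+h≤rj))
          from (below j∉S 2+rj≤1+h) = (λ j∈S → ⊥-elim (j∉S j∈S)) ,
                                      (λ 2+h≤rj → ⊥-elim (<-irrefl refl (≤-trans (n≤1+n _) (≤-trans 2+rj≤1+h (≤-trans (n≤1+n (suc h)) 2+h≤rj)))))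

      pathOf-agrees : ∀ F h a x → x ≡ a + a + h → ColumnAgrees S x h →
                      ∀ k → k ≤ F → ColumnAgrees S (x + k) (heightAt (pathOf S F h a) h k)
      pathOf-agrees F h a x x≡ agrees zero _ = subst (λ z → ColumnAgrees S z h) (sym (+-identityʳ x)) agrees
      pathOf-agrees (suc F) zero a x x≡ agrees (suc k) (s≤s k≤F) =
        subst (λ z → ColumnAgrees S z (heightAt (pathOf S F 1 a) 1 k)) (sym (+-suc x k))
          (pathOf-agrees F 1 a (suc x) (trans (cong suc x≡) (sym (+-suc (a + a) 0))) (agrees-up-from-zero {a = a} x≡ agrees) k k≤F)
      pathOf-agrees (suc F) (suc h) a x x≡ agrees (suc k) (s≤s k≤F) with rootIn? S a (suc h)
      ... | yes root = subst (λ z → ColumnAgrees S z (heightAt (pathOf S F h (suc a)) h k)) (sym (+-suc x k))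
          (pathOf-agrees F h (suc a) (suc x) (trans (cong suc x≡) (shift a h)) (agrees-down {a = a} x≡ agrees root) k k≤F)
        where
          shift : ∀ a h → suc (a + a + suc h) ≡ suc a + suc a + h
          shift = solve-∀
      ... | no ¬root = subst (λ z → ColumnAgrees S z (heightAt (pathOf S F (suc (suc h)) a) (suc (suc h)) k)) (sym (+-suc x k))
          (pathOf-agrees F (suc (suc h)) a (suc x) (trans (cong suc x≡) (sym (+-suc (a + a) (suc h)))) (agrees-up {a = a} x≡ agrees ¬root) k k≤F)

      idealOf-surjective : Σ (List Bool) λ w → IsBallot 0 w × length w ≡ pathLength n × idealOf n w ≡ S
      idealOf-surjective = w , pathOf-IsBallot S (pathLength n) 0 0 , pathOf-length S (pathLength n) 0 0 ,
                           ⊆-antisym (λ {j} j∈ → proj₂ (agrees j) (∈-idealOf⁻ n w j j∈))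
                                     (λ {j} j∈S → ∈-idealOf⁺ n w j (proj₁ (agrees j) j∈S))
        where
          w = pathOf S (pathLength n) 0 0
          column-0-empty : ColumnAgrees S 0 0
          column-0-empty j cj = ⊥-elim (0≢1+n (trans (sym cj) (+-suc (lead n j + lead n j) (rank n j))))
          agrees : ∀ j → (j ∈ S → heightAt w 0 (column n j) ≤ rank n j) × (heightAt w 0 (column n j) ≤ rank n j → j ∈ S)
          agrees j = pathOf-agrees (pathLength n) 0 0 0 refl column-0-empty (column n j) (column≤pathLength n j) j refl

module PeaksAndMaximalRoots where

  open import Defs
  open PeakCounting using (peaks)
  open RootPoset
  open BallotPaths
  open UpperSets
  open IdealsOfPaths

  open import Data.Bool using (Bool; false)
  open import Data.Empty using (⊥-elim)
  open import Data.Fin using (Fin)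
  open import Data.Fin.Subset using (_∈_; _∉_)
  open import Data.List using (List; length)
  open import Data.List.Membership.Propositional using () renaming (_∈_ to _∈ₗ_)
  open import Data.Nat
  open import Data.Nat.Properties
  open import Data.Nat.Tactic.RingSolver using (solve-∀)
  open import Data.Product using (Σ; _,_; _×_; proj₁; proj₂)
  open import Data.Sum using (_⊎_; inj₁; inj₂)
  import Data.Sum as Sum
  open import Relation.Binary.PropositionalEquality
    using (_≡_; _≢_; refl; sym; trans; cong; cong₂; subst; module ≡-Reasoning)
  open import Relation.Nullary using (Dec; yes; no)

  module _ (n : ℕ) where

    private
      H : List Bool → ℕ → ℕ
      H w = heightAt w 0

    peak-neighbour-height : ∀ {w X x} → IsHighPeak 0 false w X → length w ≡ pathLength n → x ≤ pathLength n →
      x ≡ suc X ⊎ X ≡ suc x → H w x ≤ H w X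
    peak-neighbour-height {w} {X} {x} (highPeak _ _ _ (inj₁ X≡|w|)) |w| x≤ (inj₁ x≡1+X) =
      ⊥-elim (<-irrefl refl (≤-trans (≤-reflexive (sym x≡1+X)) (≤-trans x≤ (≤-reflexive (trans (sym |w|) (sym X≡|w|))))))
    peak-neighbour-height {w} {X} {x} (highPeak _ _ _ (inj₂ falls)) _ _ (inj₁ refl) = ≤-trans (n≤1+n _) (≤-reflexive falls)
    peak-neighbour-height {w} {.(suc x)} {x} (highPeak _ _ rises _) _ _ (inj₂ refl) = ≤-trans (n≤1+n _) (≤-reflexive rises)

    peak⇒IsMaximalOutside : ∀ {w X} → IsBallot 0 w → length w ≡ pathLength n → X ∈ₗ peaks 0 false w →
      Σ (Fin (N n)) λ j → column n j ≡ X × suc (rank n j) ≡ H w X × lead n j ≡ downSteps w X ×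
                          IsMaximalOutside (Covers n) (idealOf n w) j
    peak⇒IsMaximalOutside {w} {X} w-ballot |w| X∈ = j , column-j , 1+rank-j , lead-j , j∉ , above-j
      where
        peak = ∈-peaks⁻ 0 false w X X∈
        at = root-at-column n X (H w X) (downSteps w X)
               (heightAt+downSteps w 0 X w-ballot (IsHighPeak.within peak))
               (subst (X ≤_) |w| (IsHighPeak.within peak)) (IsHighPeak.high peak)
        j = proj₁ at
        column-j = proj₁ (proj₂ at)
        1+rank-j = proj₁ (proj₂ (proj₂ at))
        lead-j = proj₂ (proj₂ (proj₂ at))
        j∉ : j ∉ idealOf n w
        j∉ j∈ = <-irrefl refl (≤-trans (≤-reflexive 1+rank-j)
                                 (subst (λ x → H w x ≤ rank n j) column-j (∈-idealOf⁻ n w j j∈)))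
        above-j : ∀ p → Covers n p j → p ∈ idealOf n w
        above-j p p⋗j = ∈-idealOf⁺ n w p (subst (H w (column n p) ≤_) HX≡rank-p
          (peak-neighbour-height peak |w| (column≤pathLength n p)
            (Sum.map (λ e → trans e (cong suc column-j)) (λ e → trans (sym column-j) e) (Covers⇒adjacent-columns n p⋗j))))
          where
            HX≡rank-p : H w X ≡ rank n p
            HX≡rank-p = trans (sym 1+rank-j) (sym (proj₁ (Covers⁻ n p j p⋗j)))

    module _ {w : List Bool} (w-ballot : IsBallot 0 w) (|w| : length w ≡ pathLength n) {j : Fin (N n)}
             (j∉ : j ∉ idealOf n w) (above-j : ∀ p → Covers n p j → p ∈ idealOf n w) where

      private
        a = lead n j
        r = rank n j
        X = column n j
        X′ = a + a + r

        X≡1+X′ : X ≡ suc X′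
        X≡1+X′ = +-suc (a + a) r

        X≤|w| : X ≤ length w
        X≤|w| = subst (X ≤_) (sym |w|) (column≤pathLength n j)

        height+2·downSteps : ∀ x → x ≤ length w → H w x + downSteps w x + downSteps w x ≡ x
        height+2·downSteps x x≤ = heightAt+downSteps w 0 x w-ballot x≤

        1+r≤HX : suc r ≤ H w X
        1+r≤HX = ≰⇒> (λ HX≤r → j∉ (∈-idealOf⁺ n w j HX≤r))

        covering-height : ∀ {q x} → column n q ≡ x → rank n q ≡ suc r → Covers n q j → H w x ≤ suc r
        covering-height {q} cq rq q⋗j =
          subst (λ x → H w x ≤ suc r) cq (subst (H w (column n q) ≤_) rq (∈-idealOf⁻ n w q (above-j q q⋗j)))

        HX′≤1+r : H w X′ ≤ suc r
        HX′≤1+r = by-lead (1 ≤? a)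
          where
            by-lead : Dec (1 ≤ a) → H w X′ ≤ suc r
            by-lead (no 1≰a) = ≤-trans (heightAt-≤ w 0 X′)
              (≤-trans (≤-reflexive (cong (λ a → a + a + r) (n<1⇒n≡0 (≰⇒> 1≰a)))) (n≤1+n r))
            by-lead (yes 1≤a) =
              let q , column-q , rq≡1+r , q⋗j = covering-in-previous-column n X≡1+X′ 1≤a
              in covering-height column-q rq≡1+r q⋗j

      heightAt-column≡1+rank : H w X ≡ suc r
      heightAt-column≡1+rank = same-parity∧adjacent⇒≡ (downSteps w X) a
        (trans (height+2·downSteps X X≤|w|) (d+d+r≡r+d+d a (suc r)))
        (≤-trans (≤-reflexive (cong (H w) X≡1+X′)) (≤-trans (heightAt-suc-≤ w 0 X′) (s≤s HX′≤1+r)))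
        (≤-trans 1+r≤HX (n≤1+n _))

      downSteps-column≡lead : downSteps w X ≡ a
      downSteps-column≡lead = half-injective (+-cancelˡ-≡ (suc r) _ _ (begin
        suc r + (d + d)    ≡⟨ +-assoc (suc r) d d ⟨
        suc r + d + d      ≡⟨ cong (λ h → h + d + d) heightAt-column≡1+rank ⟨
        H w X + d + d      ≡⟨ height+2·downSteps X X≤|w| ⟩
        X                  ≡⟨ d+d+r≡r+d+d a (suc r) ⟩
        suc r + a + a      ≡⟨ +-assoc (suc r) a a ⟩
        suc r + (a + a)    ∎))
        where
          open ≡-Reasoning
          d = downSteps w X

      private
        HX′≡r : H w X′ ≡ r
        HX′≡r = same-parity∧adjacent⇒≡ (downSteps w X′) a
          (trans (height+2·downSteps X′ (≤-trans (n≤1+n X′) (subst (_≤ length w) X≡1+X′ X≤|w|))) (d+d+r≡r+d+d a r))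
          HX′≤1+r
          (≤-trans (≤-pred (≤-trans (≤-reflexive (sym heightAt-column≡1+rank))
                                    (≤-trans (≤-reflexive (cong (H w) X≡1+X′)) (heightAt-suc-≤ w 0 X′))))
                   (n≤1+n _))

        rises : RisesTo 0 false w X
        rises = subst (RisesTo 0 false w) (sym X≡1+X′)
                  (trans (cong suc HX′≡r) (trans (sym heightAt-column≡1+rank) (cong (H w) X≡1+X′)))

        falls-before-end : X ≢ pathLength n → suc (H w (suc X)) ≡ H w X
        falls-before-end X≢L = trans (cong suc H[1+X]≡r) (sym heightAt-column≡1+rank)
          where
            X≤2n : X ≤ n + n
            X≤2n = ≤-pred (≤∧≢⇒< (column≤pathLength n j) X≢L)
            H[1+X]≤1+r : H w (suc X) ≤ suc r
            H[1+X]≤1+r = let q , column-q , rq≡1+r , q⋗j = covering-in-next-column n X≤2n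
                         in covering-height column-q rq≡1+r q⋗j
            shift : ∀ a r → suc (a + a + suc r) ≡ r + suc a + suc a
            shift = solve-∀
            H[1+X]≡r : H w (suc X) ≡ r
            H[1+X]≡r = same-parity∧adjacent⇒≡ (downSteps w (suc X)) (suc a)
              (trans (height+2·downSteps (suc X) (subst (suc X ≤_) (sym |w|) (s≤s X≤2n))) (shift a r))
              H[1+X]≤1+r
              (≤-pred (≤-trans (≤-reflexive (sym heightAt-column≡1+rank)) (≤-trans (heightAt-≤-suc w 0 X) (n≤1+n _))))

        falls : X ≡ length w ⊎ suc (H w (suc X)) ≡ H w X
        falls with X ≟ pathLength n
        ... | yes X≡L = inj₁ (trans X≡L (sym |w|))
        ... | no  X≢L = inj₂ (falls-before-end X≢L)

      IsMaximalOutside⇒peak : X ∈ₗ peaks 0 false w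
      IsMaximalOutside⇒peak = ∈-peaks⁺ 0 false w X w-ballot
        (highPeak X≤|w| (subst (2 ≤_) (sym heightAt-column≡1+rank) (s≤s (proj₁ (rank-lead-bounds n j)))) rises falls)

open import Defs
open import Data.Bool using (Bool; false)
open import Data.Fin.Subset using (Subset; _∈_; _∪_; ⁅_⁆)
open import Data.Fin.Subset.Properties using (x∈⁅x⁆; x∈⁅y⁆⇒x≡y; q⊆p∪q; ⊆-antisym)
open import Data.List using (List; map; concatMap; length)
open import Data.List.Properties using (length-map; map-cong)
open import Data.List.Membership.Propositional using (find; lose) renaming (_∈_ to _∈ₗ_)
open import Data.List.Membership.Propositional.Properties using (∈-map⁺; ∈-map⁻; ∈-concatMap⁺; ∈-concatMap⁻)
open import Data.Nat
open import Data.Nat.Properties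
open import Data.Nat.Combinatorics using (_C_)
open import Data.Nat.ListAction using (sum)
open import Data.List.Relation.Unary.Unique.Propositional using (Unique)
open import Data.Product using (_,_; _×_; proj₁; proj₂)
open import Function.Bundles using (mk⇔)
open import Relation.Binary.PropositionalEquality using (_≡_; sym; trans; cong; subst; module ≡-Reasoning)
open import Relation.Nullary.Decidable using (_×-dec_)

open Lists
open PeakCounting
open RootPoset
open BallotPaths
open UpperSets
open IdealsOfPaths
open PathsOfIdeals
open PeaksAndMaximalRoots

module _ (n : ℕ) where

  rootsAt : ℕ → ℕ → Subset (N n)
  rootsAt a r = subsetOf (λ j → (lead n j ≟ a) ×-dec (rank n j ≟ r))

  rootsAt≡⁅⁆ : ∀ {j a r} → lead n j ≡ a → rank n j ≡ r → rootsAt a r ≡ ⁅ j ⁆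
  rootsAt≡⁅⁆ {j} {a} {r} lj≡a rj≡r = ⊆-antisym
    (λ {k} k∈ → let lk≡a , rk≡r = ∈-subsetOf⁻ (λ j → (lead n j ≟ a) ×-dec (rank n j ≟ r)) k∈ in
                subst (_∈ ⁅ j ⁆) (lead-rank-injective n (trans lj≡a (sym lk≡a)) (trans rj≡r (sym rk≡r))) (x∈⁅x⁆ j))
    (λ {k} k∈ → subst (_∈ rootsAt a r) (sym (x∈⁅y⁆⇒x≡y j k∈)) (∈-subsetOf⁺ (λ j → (lead n j ≟ a) ×-dec (rank n j ≟ r)) (lj≡a , rj≡r)))

  -- The root added at the peak in position X has lead = number of down steps before X and
  -- rank = height of the peak − 1.
  edgeAt : List Bool → ℕ → Subset (N n) × Subset (N n)
  edgeAt w X = idealOf n w , idealOf n w ∪ rootsAt (downSteps w X) (heightAt w 0 X ∸ 1)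

  edgesFrom : List Bool → List (Subset (N n) × Subset (N n))
  edgesFrom w = map (edgeAt w) (peaks 0 false w)

  hasseEdges : List (Subset (N n) × Subset (N n))
  hasseEdges = concatMap edgesFrom (ballotPaths (pathLength n) 0)

  edgeAt≡ : ∀ {w X j} → lead n j ≡ downSteps w X → suc (rank n j) ≡ heightAt w 0 X →
            edgeAt w X ≡ (idealOf n w , idealOf n w ∪ ⁅ j ⁆)
  edgeAt≡ {w} {X} lj≡d 1+rj≡h = cong (λ S → idealOf n w , idealOf n w ∪ S) (rootsAt≡⁅⁆ lj≡d (cong (_∸ 1) 1+rj≡h))

  ∈-hasseEdges⁻ : ∀ {e} → e ∈ₗ hasseEdges → HasseEdge n e
  ∈-hasseEdges⁻ e∈ =
    let w , w∈ , e∈w = find (∈-concatMap⁻ edgesFrom {ballotPaths (pathLength n) 0} e∈)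
        X , X∈ , e≡ = ∈-map⁻ (edgeAt w) e∈w
        w-ballot , |w| = ∈-ballotPaths⁻ (pathLength n) 0 w∈
        j , _ , 1+rj≡h , lj≡d , j-maximal = peak⇒IsMaximalOutside n w-ballot |w| X∈
    in subst (HasseEdge n) (sym (trans e≡ (edgeAt≡ {X = X} lj≡d 1+rj≡h)))
             (IsMaximalOutside⇒IsUpperSetCover (Covers n) (idealOf-IsUpperSet n w) j-maximal)

  IsMaximalOutside⇒∈-hasseEdges : ∀ {w i} → IsBallot 0 w → length w ≡ pathLength n →
    IsMaximalOutside (Covers n) (idealOf n w) i → (idealOf n w , idealOf n w ∪ ⁅ i ⁆) ∈ₗ hasseEdges
  IsMaximalOutside⇒∈-hasseEdges {w} {i} w-ballot |w| (i∉ , above-i) =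
    subst (_∈ₗ hasseEdges)
          (edgeAt≡ {X = column n i} (sym (downSteps-column≡lead n w-ballot |w| i∉ above-i))
                   (sym (heightAt-column≡1+rank n w-ballot |w| i∉ above-i)))
          (∈-concatMap⁺ edgesFrom (lose w∈ (∈-map⁺ (edgeAt w) (IsMaximalOutside⇒peak n w-ballot |w| i∉ above-i))))
    where
      w∈ : w ∈ₗ ballotPaths (pathLength n) 0
      w∈ = subst (λ L → w ∈ₗ ballotPaths L 0) |w| (∈-ballotPaths⁺ w w-ballot)

  ∈-hasseEdges⁺ : ∀ {I J} → HasseEdge n (I , J) → (I , J) ∈ₗ hasseEdges
  ∈-hasseEdges⁺ {I} {J} edge =
    let i , i-maximal , J≡I∪⁅i⁆ = IsUpperSetCover⇒IsMaximalOutside (Covers n) (rank n) (Covers⇒rank< n) edge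
        w , w-ballot , |w| , idealOf-w≡I = idealOf-surjective n (proj₁ edge)
    in subst (λ T → (I , T) ∈ₗ hasseEdges) (sym J≡I∪⁅i⁆)
         (subst (λ S → (S , S ∪ ⁅ i ⁆) ∈ₗ hasseEdges) idealOf-w≡I
           (IsMaximalOutside⇒∈-hasseEdges w-ballot |w| (subst (λ S → IsMaximalOutside (Covers n) S i) (sym idealOf-w≡I) i-maximal)))

  edgesFrom-unique : ∀ {w} → w ∈ₗ ballotPaths (pathLength n) 0 → Unique (edgesFrom w)
  edgesFrom-unique {w} w∈ = Unique-map⁺ (edgeAt w) edgeAt-injective (peaks-unique 0 false w)
    where
      w-ballot = proj₁ (∈-ballotPaths⁻ (pathLength n) 0 w∈)
      |w| = proj₂ (∈-ballotPaths⁻ (pathLength n) 0 w∈)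
      edgeAt-injective : ∀ {X Y} → X ∈ₗ peaks 0 false w → Y ∈ₗ peaks 0 false w → edgeAt w X ≡ edgeAt w Y → X ≡ Y
      edgeAt-injective {X} {Y} X∈ Y∈ X↦≡Y↦ =
        let j , column-j , 1+rj , lj , j∉ , _ = peak⇒IsMaximalOutside n w-ballot |w| X∈
            k , column-k , 1+rk , lk , _ = peak⇒IsMaximalOutside n w-ballot |w| Y∈
            ∪⁅j⁆≡∪⁅k⁆ = cong proj₂ (trans (sym (edgeAt≡ {X = X} lj 1+rj)) (trans X↦≡Y↦ (edgeAt≡ {X = Y} lk 1+rk)))
            j∈∪⁅k⁆ = subst (j ∈_) ∪⁅j⁆≡∪⁅k⁆ (q⊆p∪q (idealOf n w) ⁅ j ⁆ (x∈⁅x⁆ j))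
        in trans (sym column-j) (trans (cong (column n) (x∉p∧x∈p∪⁅y⁆⇒x≡y j∉ j∈∪⁅k⁆)) column-k)

  hasseEdges-unique : Unique hasseEdges
  hasseEdges-unique = Unique-concatMap⁺ edgesFrom edgesFrom-unique same-ideal (ballotPaths-unique (pathLength n) 0)
    where
      lower-ideal : ∀ {w e} → e ∈ₗ edgesFrom w → proj₁ e ≡ idealOf n w
      lower-ideal {w} e∈ = let _ , _ , e≡ = ∈-map⁻ (edgeAt w) e∈ in cong proj₁ e≡
      same-ideal : ∀ {w w′ e} → w ∈ₗ ballotPaths (pathLength n) 0 → w′ ∈ₗ ballotPaths (pathLength n) 0 →
                   e ∈ₗ edgesFrom w → e ∈ₗ edgesFrom w′ → w ≡ w′
      same-ideal w∈ w′∈ e∈ e∈′ =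
        let w-ballot , |w| = ∈-ballotPaths⁻ (pathLength n) 0 w∈
            w′-ballot , |w′| = ∈-ballotPaths⁻ (pathLength n) 0 w′∈
        in idealOf-injective n w-ballot w′-ballot |w| |w′| (trans (sym (lower-ideal e∈)) (lower-ideal e∈′))

  hasseEdges-length : length hasseEdges ≡ suc n * ((n + n) C suc n)
  hasseEdges-length = begin
    length hasseEdges
      ≡⟨ length-concatMap edgesFrom (ballotPaths (pathLength n) 0) ⟩
    sum (map (λ w → length (edgesFrom w)) (ballotPaths (pathLength n) 0))
      ≡⟨ cong sum (map-cong (λ w → length-map (edgeAt w) (peaks 0 false w)) (ballotPaths (pathLength n) 0)) ⟩
    peakTotal (suc (n + n)) 0 false
      ≡⟨ peakTotal-formula n ⟩
    suc n * ((n + n) C suc n) ∎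
    where open ≡-Reasoning

corollary3p2 : (n : ℕ) →
    HasCardinality (HasseEdge n) (suc n * ((n + n) C suc n))
      × suc n * ((n + n) C suc n) ≡ n * ((n + n) C n)
corollary3p2 n =
  (hasseEdges n , hasseEdges-unique n , hasseEdges-length n , λ e → mk⇔ (∈-hasseEdges⁻ n) (∈-hasseEdges⁺ n)) ,
  [1+n]*2nC[1+n]≡n*2nCn n
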